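{- Let $d\in\mathbb{N}$, let $G$ be a graph and $S\subseteq V(G)$ with $|S|=d$. For any integers $c_d,c_{d-1},\dots,c_2$ there exist a graph $G'$ containing $G$ as an induced subgraph, and values $c_1,c_0$, such that $\mathcal{E}(G';S,q)=\sum_{k=0}^{d}c_kq^k$.
   Context: Graphs are finite and simple; $N[X]$ is the closed neighborhood of $X$. Power domination process on a graph $H$ from $T\subseteq V(H)$: set $B:=N[T]$; then, while some $x\in B$ has exactly one vertex $y$ of $N[x]$ outside $B$, add $y$ to $B$. The final set is $\mathrm{Obs}(H;T)$ (with $\mathrm{Obs}(H;\emptyset)=\emptyset$). For $S\subseteq V(H)$ and $q\in[0,1]$, the expected value polynomial is $\mathcal{E}(H;S,q)=\sum_{W\subseteq S}|\mathrm{Obs}(H;W)|\,q^{|S\setminus W|}(1-q)^{|W|}$, the expected number of observed vertices when each sensor in $S$ fails independently with probability $q$ and the power domination process is run from the surviving sensors. -}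

module Defs where

open import Data.Nat using (ℕ; zero; suc)
open import Data.Bool using (Bool; true; false; _∧_; _∨_; not; if_then_else_)
open import Data.Fin using (Fin; zero; suc)
import Data.Fin as F
open import Data.Maybe using (Maybe; just; nothing)
import Data.Maybe as M
open import Data.List using (List; []; _∷_; _++_; map; foldr)
open import Data.Integer using (ℤ; +_)
open import Data.Rational using (ℚ; _+_; _*_; _-_; 0ℚ; 1ℚ; _/_)
open import Relation.Binary.PropositionalEquality using (_≡_)
open import Relation.Nullary.Decidable using (⌊_⌋)

record Graph : Set where
  field
    n      : ℕ
    adj    : Fin n → Fin n → Bool
    sym    : ∀ u v → adj u v ≡ adj v u
    irrefl : ∀ v → adj v v ≡ false
open Graph public

VSet : ℕ → Set
VSet n = Fin n → Bool

anyF : ∀ {n} → (Fin n → Bool) → Bool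
anyF {zero}  p = false
anyF {suc n} p = p zero ∨ anyF (λ i → p (suc i))

countF : ∀ {n} → (Fin n → Bool) → ℕ
countF {zero}  p = 0
countF {suc n} p = (if p zero then 1 else 0) Data.Nat.+ countF (λ i → p (suc i))

firstF : ∀ {n} → (Fin n → Bool) → Maybe (Fin n)
firstF {zero}  p = nothing
firstF {suc n} p = if p zero then just zero else M.map suc (firstF (λ i → p (suc i)))

closedAdj : (H : Graph) → Fin (n H) → Fin (n H) → Bool
closedAdj H x y = ⌊ x F.≟ y ⌋ ∨ adj H x y

closedNbhd : (H : Graph) → VSet (n H) → VSet (n H)
closedNbhd H T y = anyF (λ x → T x ∧ closedAdj H x y)

outside : (H : Graph) → VSet (n H) → Fin (n H) → VSet (n H)
outside H B x y = closedAdj H x y ∧ not (B y)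

isOne : ℕ → Bool
isOne (suc zero) = true
isOne _          = false

propStep : (H : Graph) → VSet (n H) → VSet (n H)
propStep H B with firstF (λ x → B x ∧ isOne (countF (outside H B x)))
... | nothing = B
... | just x with firstF (outside H B x)
...   | nothing = B
...   | just y  = λ v → B v ∨ ⌊ v F.≟ y ⌋

iterate : ∀ {A : Set} → ℕ → (A → A) → A → A
iterate zero    f a = a
iterate (suc k) f a = iterate k f (f a)

-- Obs(H;T): each effective step adds a vertex, so n H steps reach the final set.
Obs : (H : Graph) → VSet (n H) → VSet (n H)
Obs H T = iterate (n H) (propStep H) (closedNbhd H T)

consB : ∀ {n} → Bool → VSet n → VSet (suc n)
consB b W zero    = b
consB b W (suc i) = W i

subsetsOf : ∀ {n} → VSet n → List (VSet n)
subsetsOf {zero}  S = (λ ()) ∷ []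
subsetsOf {suc n} S =
  if S zero then map (consB true) rest ++ map (consB false) rest
            else map (consB false) rest
  where rest = subsetsOf (λ i → S (suc i))

_^ℚ_ : ℚ → ℕ → ℚ
q ^ℚ zero  = 1ℚ
q ^ℚ suc k = q * (q ^ℚ k)

ℕtoℚ : ℕ → ℚ
ℕtoℚ m = + m / 1

ℤtoℚ : ℤ → ℚ
ℤtoℚ z = z / 1

sumℚ : List ℚ → ℚ
sumℚ = foldr _+_ 0ℚ

ExpVal : (H : Graph) → VSet (n H) → ℚ → ℚ
ExpVal H S q = sumℚ (map term (subsetsOf S))
  where
  term : VSet (n H) → ℚ
  term W = ℕtoℚ (countF (Obs H W))
           * (q ^ℚ countF (λ v → S v ∧ not (W v)))
           * ((1ℚ - q) ^ℚ countF W)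

polyEval : (c : ℕ → ℤ) → ℕ → ℚ → ℚ
polyEval c zero    q = ℤtoℚ (c zero)
polyEval c (suc d) q = polyEval c d q + ℤtoℚ (c (suc d)) * (q ^ℚ suc d)

withLow : (ℕ → ℤ) → ℤ → ℤ → ℕ → ℤ
withLow c c₁ c₀ zero          = c₀
withLow c c₁ c₀ (suc zero)    = c₁
withLow c c₁ c₀ (suc (suc k)) = c (suc (suc k))

image : ∀ {m k} → (Fin m → Fin k) → VSet m → VSet k
image f S v = anyF (λ u → S u ∧ ⌊ f u F.≟ v ⌋)

InducedEmbedding : (G G' : Graph) → (Fin (n G) → Fin (n G')) → Set
InducedEmbedding G G' f =
  (∀ u v → f u ≡ f v → u ≡ v) × (∀ u v → adj G' (f u) (f v) ≡ adj G u v)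
  where open import Data.Product using (_×_)

module Submission where

-- Attach to G, for every vertex u and every sensor s, a pair of false twins adjacent to u and s.
-- Twins are never forced (one is unobserved exactly when the other is, and every vertex seeing one
-- sees both), so as soon as a sensor s survives, the twins at (u , s) force every vertex u of G,
-- and every new vertex is observed exactly when a simple event about the surviving sensors occurs.
-- Order the sensors s₁ < ⋯ < s_d.  A "prefix" pair of twins adjacent to s₁, …, s_k is observed
-- with probability 1 - q^k.  In a "fork" -- stem twins at s_k, guard twins at s₁, …, s_(k-1)
-- joined to the stems, and a leaf on the stems -- the leaf is forced exactly when s_k and one of
-- s₁, …, s_(k-1) survive, with probability (1 - q)(1 - q^(k-1)).  By linearity of expectation
-- E(G′;S,q) is the sum of these probabilities; in degrees ≥ 2 a fork of rank k contributes
-- q^k - 3q^(k-1) and a prefix pair -2q^k on top of a fixed contribution of G and of the freezing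
-- twins, so the numbers of gadgets can be chosen from degree d downwards to produce c_d, …, c_2.

open import Defs hiding (sym)
open import Level using (Level)
open import Algebra.Bundles using (CommutativeMonoid)
open import Data.Bool using (Bool; true; false; _∧_; _∨_; not; if_then_else_)
open import Data.Bool.Properties using (∨-identityʳ; ∨-zeroʳ; ∨-comm; ∧-zeroʳ; ∧-identityʳ; ⇔→≡)
open import Data.Empty using (⊥-elim)
open import Data.Fin as Fin using (Fin; zero; suc; toℕ; _↑ˡ_; _↑ʳ_; splitAt; join; combine; remQuot)
import Data.Fin.Properties as FinP
open import Data.Fin.Properties
  using (suc-injective; splitAt-↑ˡ; splitAt-↑ʳ; join-splitAt; remQuot-combine; combine-remQuot; 2↔Bool)
open import Data.Integer as ℤ using (ℤ; +_; -[1+_]; ∣_∣)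
import Data.Integer.Properties as ℤP
open import Data.Integer.Tactic.RingSolver using (solve-∀)
open import Data.List using (List; []; _∷_; _++_; map)
open import Data.List.Properties using (map-++; map-∘)
open import Data.List.Relation.Unary.All as All using (All; []; _∷_)
open import Data.List.Relation.Unary.All.Properties using (++⁺; map⁺)
open import Data.Maybe using (just; nothing)
open import Data.Nat as ℕ using (ℕ; zero; suc; z≤n; s≤s; pred; _∸_)
import Data.Nat.Properties as ℕP
open import Data.Product as Product using (Σ; ∃; _×_; _,_; proj₁; proj₂)
open import Data.Product.Properties using (≡-dec)
open import Data.Rational using (ℚ; 0ℚ; 1ℚ; _+_; _*_; _-_; -_; toℚᵘ; _≤_)
import Data.Rational.Properties as ℚP
import Data.Rational.Unnormalised as ℚᵘ
import Data.Rational.Unnormalised.Properties as ℚᵘP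
open import Data.Rational.Solver using (module +-*-Solver)
open import Data.Sum as Sum using (_⊎_; inj₁; inj₂)
open import Function using (_∘_; _↔_; Inverse; mk↔ₛ′)
open import Function.Bundles using (mk⇔)
open import Function.Properties.Inverse using (↔-refl)
open import Relation.Nullary using (Dec; yes; no)
open import Relation.Nullary.Decidable using (⌊_⌋)
open import Relation.Binary.PropositionalEquality
import Algebra.Properties.CommutativeMonoid.Sum ℚP.+-0-commutativeMonoid as ℚΣ
import Algebra.Properties.CommutativeMonoid.Sum ℤP.+-0-commutativeMonoid as ℤΣ
open +-*-Solver using (solve; _:=_; _:+_; _:*_; _:-_; :-_; con)

private
  variable
    N : ℕ
    A A′ : Set

infix 4 _⊆_
_⊆_ : VSet N → VSet N → Set
X ⊆ Y = ∀ x → X x ≡ true → Y x ≡ true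

𝕀 : Bool → ℕ
𝕀 b = if b then 1 else 0

insert : Fin N → VSet N → VSet N
insert y B v = B v ∨ ⌊ v Fin.≟ y ⌋

⁅_⁆ : Fin N → VSet N
⁅ a ⁆ x = ⌊ x Fin.≟ a ⌋

hits : VSet N → VSet N → Bool
hits A W = anyF (λ x → A x ∧ W x)

∧-true : ∀ {a b} → a ∧ b ≡ true → a ≡ true × b ≡ true
∧-true {true} {true} refl = refl , refl

∨-true : ∀ {a b} → a ∨ b ≡ true → a ≡ true ⊎ b ≡ true
∨-true {true} _ = inj₁ refl
∨-true {false} e = inj₂ e

not-true : ∀ {b} → not b ≡ true → b ≡ false
not-true {false} _ = refl

≟-refl : (x : Fin N) → ⌊ x Fin.≟ x ⌋ ≡ true
≟-refl x with x Fin.≟ x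
... | yes _ = refl
... | no x≢x = ⊥-elim (x≢x refl)

≟-true : {x y : Fin N} → ⌊ x Fin.≟ y ⌋ ≡ true → x ≡ y
≟-true {x = x} {y} e with x Fin.≟ y
... | yes x≡y = x≡y

≟-sym : (x y : Fin N) → ⌊ x Fin.≟ y ⌋ ≡ ⌊ y Fin.≟ x ⌋
≟-sym x y with x Fin.≟ y | y Fin.≟ x
... | yes _ | yes _ = refl
... | no _ | no _ = refl
... | yes x≡y | no y≢x = ⊥-elim (y≢x (sym x≡y))
... | no x≢y | yes y≡x = ⊥-elim (x≢y (sym y≡x))

anyF-intro : {p : Fin N → Bool} (i : Fin N) → p i ≡ true → anyF p ≡ true
anyF-intro {p = p} zero e rewrite e = refl
anyF-intro {p = p} (suc i) e with p zero
... | true = refl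
... | false = anyF-intro i e

anyF-elim : {p : Fin N → Bool} → anyF p ≡ true → ∃ λ i → p i ≡ true
anyF-elim {suc N} {p} e with p zero in p0
... | true = zero , p0
... | false with i , pi ← anyF-elim e = suc i , pi

anyF-none : {p : Fin N → Bool} → (∀ i → p i ≡ false) → anyF p ≡ false
anyF-none {zero} _ = refl
anyF-none {suc N} {p} none rewrite none zero = anyF-none (none ∘ suc)

anyF-cong : {p p′ : Fin N → Bool} → (∀ i → p i ≡ p′ i) → anyF p ≡ anyF p′
anyF-cong {zero} _ = refl
anyF-cong {suc N} p≗p′ = cong₂ _∨_ (p≗p′ zero) (anyF-cong (p≗p′ ∘ suc))

anyF-⁅⁆ : (a : Fin N) (p : Fin N → Bool) → anyF (λ x → ⁅ a ⁆ x ∧ p x) ≡ p a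
anyF-⁅⁆ a p with p a in pa
... | true = anyF-intro a (trans (cong (_∧ p a) (≟-refl a)) pa)
... | false = anyF-none only-a
  where
  only-a : ∀ x → ⁅ a ⁆ x ∧ p x ≡ false
  only-a x with x Fin.≟ a
  ... | yes refl = pa
  ... | no _ = refl

countF-cong : {p p′ : Fin N → Bool} → (∀ i → p i ≡ p′ i) → countF p ≡ countF p′
countF-cong {zero} _ = refl
countF-cong {suc N} p≗p′ = cong₂ ℕ._+_ (cong 𝕀 (p≗p′ zero)) (countF-cong (p≗p′ ∘ suc))

countF-none : {p : Fin N → Bool} → (∀ i → p i ≡ false) → countF p ≡ 0
countF-none {zero} _ = refl
countF-none {suc N} {p} none rewrite none zero = countF-none (none ∘ suc)

countF-≤ : (p : Fin N → Bool) → countF p ℕ.≤ N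
countF-≤ {zero} p = z≤n
countF-≤ {suc N} p with p zero
... | true = s≤s (countF-≤ (p ∘ suc))
... | false = ℕP.m≤n⇒m≤1+n (countF-≤ (p ∘ suc))

countF-mono : {p p′ : Fin N → Bool} → p ⊆ p′ → countF p ℕ.≤ countF p′
countF-mono {zero} _ = z≤n
countF-mono {suc N} {p} {p′} p⊆p′ with p zero in p0 | p′ zero in p′0
... | true | true = s≤s (countF-mono (p⊆p′ ∘ suc))
... | false | true = ℕP.m≤n⇒m≤1+n (countF-mono (p⊆p′ ∘ suc))
... | false | false = countF-mono (p⊆p′ ∘ suc)
... | true | false with () ← trans (sym (p⊆p′ zero p0)) p′0

countF-full : (p : Fin N → Bool) → N ℕ.≤ countF p → ∀ i → p i ≡ true
countF-full {suc N} p full i with p zero in p0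
countF-full {suc N} p (s≤s full) zero | true = p0
countF-full {suc N} p (s≤s full) (suc i) | true = countF-full (p ∘ suc) full i
... | false = ⊥-elim (ℕP.<-irrefl refl (ℕP.≤-trans full (countF-≤ (p ∘ suc))))

countF-witness : (p : Fin N → Bool) {k : ℕ} → countF p ≡ suc k → ∃ λ i → p i ≡ true
countF-witness {suc N} p c with p zero in p0
... | true = zero , p0
... | false with i , pi ← countF-witness (p ∘ suc) c = suc i , pi

countF-pos : {p : Fin N → Bool} (i : Fin N) → p i ≡ true → 1 ℕ.≤ countF p
countF-pos {p = p} zero pi rewrite pi = s≤s z≤n
countF-pos {p = p} (suc i) pi = ℕP.≤-trans (countF-pos i pi) (ℕP.m≤n+m _ (𝕀 (p zero)))

countF-two : {p : Fin N → Bool} (i j : Fin N) → p i ≡ true → p j ≡ true → i ≢ j → 2 ℕ.≤ countF p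
countF-two zero zero _ _ i≢j = ⊥-elim (i≢j refl)
countF-two zero (suc j) pi pj _ rewrite pi = s≤s (countF-pos j pj)
countF-two (suc i) zero pi pj _ rewrite pj = s≤s (countF-pos i pi)
countF-two {p = p} (suc i) (suc j) pi pj i≢j =
  ℕP.≤-trans (countF-two i j pi pj (i≢j ∘ cong suc)) (ℕP.m≤n+m _ (𝕀 (p zero)))

countF≡1 : {p : Fin N → Bool} (y : Fin N) → p y ≡ true → (∀ z → p z ≡ true → z ≡ y) → countF p ≡ 1
countF≡1 {suc N} {p} zero py unique rewrite py = cong suc (countF-none rest)
  where
  rest : ∀ i → p (suc i) ≡ false
  rest i with p (suc i) in e
  ... | true with () ← unique (suc i) e
  ... | false = refl
countF≡1 {suc N} {p} (suc y) py unique with p zero in p0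
... | true with () ← unique zero p0
... | false = countF≡1 y py (λ z pz → suc-injective (unique (suc z) pz))

countF≡1-unique : {p : Fin N → Bool} → countF p ≡ 1 → ∀ {i j} → p i ≡ true → p j ≡ true → i ≡ j
countF≡1-unique c {i} {j} pi pj with i Fin.≟ j
... | yes i≡j = i≡j
... | no i≢j with s≤s () ← subst (2 ℕ.≤_) c (countF-two i j pi pj i≢j)

countF-insert : (B : VSet N) (y : Fin N) → B y ≡ false → countF (insert y B) ≡ suc (countF B)
countF-insert {suc N} B zero By rewrite By = cong suc (countF-cong (λ i → ∨-identityʳ (B (suc i))))
countF-insert {suc N} B (suc y) By =
  trans (cong₂ ℕ._+_ (cong 𝕀 (∨-identityʳ (B zero))) (trans (countF-cong shift) (countF-insert (B ∘ suc) y By)))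
        (ℕP.+-suc _ _)
  where
  shift : ∀ i → insert (suc y) B (suc i) ≡ insert y (B ∘ suc) i
  shift i with i Fin.≟ y
  ... | yes _ = refl
  ... | no _ = refl

countF-⁅⁆ : (a : Fin N) → countF ⁅ a ⁆ ≡ 1
countF-⁅⁆ a = countF≡1 a (≟-refl a) (λ _ → ≟-true)

∩-⊆ : {P S : VSet N} → P ⊆ S → ∀ x → (P x ∧ S x) ≡ P x
∩-⊆ {P = P} P⊆S x with P x in Px
... | true = P⊆S x Px
... | false = refl

firstF-just : {p : Fin N → Bool} {i : Fin N} → firstF p ≡ just i → p i ≡ true
firstF-just {suc N} {p} e with p zero in p0
firstF-just {suc N} {p} refl | true = p0
... | false with firstF (p ∘ suc) in e′
firstF-just {suc N} {p} refl | false | just _ = firstF-just e′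

firstF-nothing : {p : Fin N → Bool} → firstF p ≡ nothing → ∀ i → p i ≡ false
firstF-nothing {suc N} {p} e i with p zero in p0
firstF-nothing {suc N} {p} e zero | false = p0
firstF-nothing {suc N} {p} e (suc i) | false with firstF (p ∘ suc) in e′
firstF-nothing {suc N} {p} e (suc i) | false | nothing = firstF-nothing e′ i

module _ {M : ℕ} (f : Fin M → Fin N) where

  image-intro : {P : VSet M} (u : Fin M) → P u ≡ true → image f P (f u) ≡ true
  image-intro u Pu = anyF-intro u (trans (cong (_∧ ⌊ f u Fin.≟ f u ⌋) Pu) (≟-refl (f u)))

  image-elim : {P : VSet M} {y : Fin N} → image f P y ≡ true → ∃ λ u → f u ≡ y × P u ≡ true
  image-elim e with u , e′ ← anyF-elim e with Pu , fu≡y ← ∧-true e′ = u , ≟-true fu≡y , Pu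

  image-⊆ : {P Q : VSet M} → P ⊆ Q → image f P ⊆ image f Q
  image-⊆ P⊆Q y e with u , refl , Pu ← image-elim e = image-intro u (P⊆Q u Pu)

  hits-image : (P : VSet M) (W : VSet N) → hits (image f P) W ≡ anyF (λ u → P u ∧ W (f u))
  hits-image P W = ⇔→≡ {z = true} (mk⇔ to from)
    where
    to : hits (image f P) W ≡ true → anyF (λ u → P u ∧ W (f u)) ≡ true
    to e with y , e′ ← anyF-elim e with in-image , Wy ← ∧-true e′ with u , refl , Pu ← image-elim {y = y} in-image =
      anyF-intro u (trans (cong (_∧ W (f u)) Pu) Wy)
    from : anyF (λ u → P u ∧ W (f u)) ≡ true → hits (image f P) W ≡ true
    from e with u , e′ ← anyF-elim e with Pu , Wfu ← ∧-true e′ =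
      anyF-intro (f u) (trans (cong (_∧ W (f u)) (image-intro u Pu)) Wfu)

  image-∋ : (∀ {u v} → f u ≡ f v → u ≡ v) → (P : VSet M) (u : Fin M) → image f P (f u) ≡ P u
  image-∋ f-injective P u = ⇔→≡ {z = true} (mk⇔ to (image-intro u))
    where
    to : image f P (f u) ≡ true → P u ≡ true
    to e with v , fv≡fu , Pv ← image-elim e rewrite f-injective fv≡fu = Pv

countF-image : ∀ {M} (f : Fin M → Fin N) → (∀ {u v} → f u ≡ f v → u ≡ v) → (P : VSet M) →
               countF (image f P) ≡ countF P
countF-image {M = zero} f _ P = countF-none {p = image f P} (λ _ → refl)
countF-image {N} {suc M} f f-injective P with P zero in P0
... | false = countF-image (f ∘ suc) (suc-injective ∘ f-injective) (P ∘ suc)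
... | true =
  trans (countF-cong (λ v → trans (∨-comm _ (rest v)) (cong (rest v ∨_) (≟-sym (f zero) v))))
        (trans (countF-insert rest (f zero) fresh) (cong suc IH))
  where
  rest : VSet N
  rest = image (f ∘ suc) (P ∘ suc)
  IH : countF rest ≡ countF (P ∘ suc)
  IH = countF-image (f ∘ suc) (suc-injective ∘ f-injective) (P ∘ suc)
  fresh : rest (f zero) ≡ false
  fresh with rest (f zero) in e
  ... | false = refl
  ... | true with u , fsu≡f0 , _ ← image-elim (f ∘ suc) e with () ← f-injective fsu≡f0

-- Power domination as a closure

Closed : (H : Graph) → VSet (n H) → Set
Closed H R = ∀ x → R x ≡ true → countF (outside H R x) ≢ 1

module _ (H : Graph) where

  private
    variable
      B B′ R : VSet (n H)

    isOne⇒1 : ∀ c → isOne c ≡ true → c ≡ 1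
    isOne⇒1 (suc zero) _ = refl

    nothing-outside : (∀ z → B z ≡ true) → ∀ x z → outside H B x z ≡ false
    nothing-outside {B} full x z rewrite full z = ∧-zeroʳ (closedAdj H x z)

  force : Closed H R → ∀ {x y} → R x ≡ true → closedAdj H x y ≡ true →
          (∀ z → closedAdj H x z ≡ true → R z ≡ false → z ≡ y) → R y ≡ true
  force {R} closed {x} {y} Rx xy unique with R y in Ry
  ... | true = refl
  ... | false = ⊥-elim (closed x Rx (countF≡1 y outside-y outside-unique))
    where
    outside-y : outside H R x y ≡ true
    outside-y rewrite xy | Ry = refl
    outside-unique : ∀ z → outside H R x z ≡ true → z ≡ y
    outside-unique z e with closedAdj H x z in xz | R z in Rz
    ... | true | false = unique z xz Rz

  full-closed : (∀ x → B x ≡ true) → Closed H B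
  full-closed full x _ one with () ← trans (sym one) (countF-none (nothing-outside full x))

  data StepView (B : VSet (n H)) : VSet (n H) → Set where
    stalled : Closed H B → StepView B B
    forces  : ∀ x y → B x ≡ true → countF (outside H B x) ≡ 1 → outside H B x y ≡ true →
              StepView B (insert y B)

  stepView : (B : VSet (n H)) → StepView B (propStep H B)
  stepView B with firstF (λ x → B x ∧ isOne (countF (outside H B x))) in e₁
  ... | nothing = stalled closed
    where
    closed : Closed H B
    closed x Bx c with () ← trans (sym (firstF-nothing e₁ x)) (cong₂ (λ b c → b ∧ isOne c) Bx c)
  ... | just x with Bx , one ← ∧-true (firstF-just e₁) with firstF (outside H B x) in e₂
  ...   | just y = forces x y Bx (isOne⇒1 _ one) (firstF-just e₂)
  ...   | nothing with () ← trans (sym (isOne⇒1 _ one)) (countF-none (firstF-nothing e₂))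

  view-⊇ : StepView B B′ → B ⊆ B′
  view-⊇ (stalled _) x Bx = Bx
  view-⊇ (forces _ _ _ _ _) x Bx rewrite Bx = refl

  view-fixed : Closed H B → StepView B B′ → B′ ≡ B
  view-fixed _ (stalled _) = refl
  view-fixed closed (forces x _ Bx one _) = ⊥-elim (closed x Bx one)

  view-grows : StepView B B′ → Closed H B ⊎ countF B′ ≡ suc (countF B)
  view-grows (stalled closed) = inj₁ closed
  view-grows {B} (forces x y _ _ outside-y) with B y in By
  ... | false = inj₂ (countF-insert B y By)
  ... | true with () ← proj₂ (∧-true {closedAdj H x y} outside-y)

  view-⊆ : Closed H R → B ⊆ R → StepView B B′ → B′ ⊆ R
  view-⊆ _ B⊆R (stalled _) = B⊆R
  view-⊆ {R} {B} closed B⊆R (forces x y Bx one outside-y) v e with ∨-true e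
  ... | inj₁ Bv = B⊆R v Bv
  ... | inj₂ v≡y rewrite ≟-true v≡y = force closed (B⊆R x Bx) (proj₁ (∧-true outside-y)) unique
    where
    unique : ∀ z → closedAdj H x z ≡ true → R z ≡ false → z ≡ y
    unique z xz Rz with B z in Bz
    ... | true with () ← trans (sym (B⊆R z Bz)) Rz
    ... | false = countF≡1-unique one (cong₂ (λ a b → a ∧ not b) xz Bz) outside-y

  iterate-fixed : ∀ {A : Set} (f : A → A) {a} → f a ≡ a → ∀ k → iterate k f a ≡ a
  iterate-fixed f fa≡a zero = refl
  iterate-fixed f fa≡a (suc k) rewrite fa≡a = iterate-fixed f fa≡a k

  iterate-⊇ : ∀ k B → B ⊆ iterate k (propStep H) B
  iterate-⊇ zero B x Bx = Bx
  iterate-⊇ (suc k) B x Bx = iterate-⊇ k (propStep H B) x (view-⊇ (stepView B) x Bx)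

  iterate-⊆ : Closed H R → ∀ k B → B ⊆ R → iterate k (propStep H) B ⊆ R
  iterate-⊆ closed zero B B⊆R = B⊆R
  iterate-⊆ closed (suc k) B B⊆R = iterate-⊆ closed k (propStep H B) (view-⊆ closed B⊆R (stepView B))

  iterate-closed : ∀ k B → n H ℕ.≤ k ℕ.+ countF B → Closed H (iterate k (propStep H) B)
  iterate-closed zero B full = full-closed (countF-full B full)
  iterate-closed (suc k) B bound with view-grows (stepView B)
  ... | inj₁ closed = subst (Closed H) (sym (iterate-fixed (propStep H) (view-fixed closed (stepView B)) (suc k))) closed
  ... | inj₂ grows = iterate-closed k (propStep H B) (ℕP.≤-trans bound (ℕP.≤-reflexive shift))
    where
    shift : suc k ℕ.+ countF B ≡ k ℕ.+ countF (propStep H B)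
    shift = trans (sym (ℕP.+-suc k (countF B))) (cong (λ c → k ℕ.+ c) (sym grows))

  Obs-closed : ∀ T → Closed H (Obs H T)
  Obs-closed T = iterate-closed (n H) (closedNbhd H T) (ℕP.m≤m+n (n H) _)

  closedNbhd⊆Obs : ∀ T → closedNbhd H T ⊆ Obs H T
  closedNbhd⊆Obs T = iterate-⊇ (n H) (closedNbhd H T)

  Obs-least : ∀ T → Closed H R → closedNbhd H T ⊆ R → Obs H T ⊆ R
  Obs-least T closed = iterate-⊆ closed (n H) (closedNbhd H T)

-- Expected values over the random set of surviving sensors

misses : VSet N → VSet N → Bool
misses A W = not (hits A W)

contains : VSet N → VSet N → Bool
contains C W = misses C (not ∘ W)

𝟙 : Bool → ℚ
𝟙 true = 1ℚ
𝟙 false = 0ℚ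

sumℚ-++ : (xs ys : List ℚ) → sumℚ (xs ++ ys) ≡ sumℚ xs + sumℚ ys
sumℚ-++ [] ys = sym (ℚP.+-identityˡ _)
sumℚ-++ (x ∷ xs) ys = trans (cong (λ y → x + y) (sumℚ-++ xs ys)) (sym (ℚP.+-assoc x _ _))

sumℚ-map-cong : {f g : A → ℚ} {xs : List A} → All (λ x → f x ≡ g x) xs → sumℚ (map f xs) ≡ sumℚ (map g xs)
sumℚ-map-cong [] = refl
sumℚ-map-cong (e ∷ es) = cong₂ _+_ e (sumℚ-map-cong es)

sumℚ-map-+ : (f g : A → ℚ) (xs : List A) →
             sumℚ (map (λ x → f x + g x) xs) ≡ sumℚ (map f xs) + sumℚ (map g xs)
sumℚ-map-+ f g [] = refl
sumℚ-map-+ f g (x ∷ xs) = trans (cong (λ y → f x + g x + y) (sumℚ-map-+ f g xs)) (middle-swap (f x) (g x) _ _)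
  where
  middle-swap : ∀ a b c d → a + b + (c + d) ≡ a + c + (b + d)
  middle-swap = solve 4 (λ a b c d → a :+ b :+ (c :+ d) := a :+ c :+ (b :+ d)) refl

sumℚ-map-*ˡ : (k : ℚ) (f : A → ℚ) (xs : List A) → sumℚ (map (λ x → k * f x) xs) ≡ k * sumℚ (map f xs)
sumℚ-map-*ˡ k f [] = sym (ℚP.*-zeroʳ k)
sumℚ-map-*ˡ k f (x ∷ xs) = trans (cong (λ y → k * f x + y) (sumℚ-map-*ˡ k f xs)) (sym (ℚP.*-distribˡ-+ k (f x) _))

subsetsOf-⊆ : (S : VSet N) → All (_⊆ S) (subsetsOf S)
subsetsOf-⊆ {zero} S = (λ ()) ∷ []
subsetsOf-⊆ {suc N} S with S zero in S0
... | true = ++⁺ (map⁺ (All.map (extend true) IH)) (map⁺ (All.map (extend false) IH))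
  where
  IH : All (_⊆ (S ∘ suc)) (subsetsOf (S ∘ suc))
  IH = subsetsOf-⊆ (S ∘ suc)
  extend : ∀ b {W} → W ⊆ (S ∘ suc) → consB b W ⊆ S
  extend b W⊆ zero _ = S0
  extend b W⊆ (suc x) = W⊆ x
... | false = map⁺ (All.map extend (subsetsOf-⊆ (S ∘ suc)))
  where
  extend : ∀ {W} → W ⊆ (S ∘ suc) → consB false W ⊆ S
  extend W⊆ (suc x) = W⊆ x

module Expectation (q : ℚ) where

  open ≡-Reasoning

  weight : VSet N → VSet N → ℚ
  weight S W = (q ^ℚ countF (λ v → S v ∧ not (W v))) * ((1ℚ - q) ^ℚ countF W)

  𝔼 : VSet N → (VSet N → ℚ) → ℚ
  𝔼 S Φ = sumℚ (map (λ W → Φ W * weight S W) (subsetsOf S))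

  ExpVal≡𝔼 : (H : Graph) (S : VSet (n H)) → ExpVal H S q ≡ 𝔼 S (λ W → ℕtoℚ (countF (Obs H W)))
  ExpVal≡𝔼 H S = sumℚ-map-cong (All.universal (λ W → ℚP.*-assoc (ℕtoℚ (countF (Obs H W))) _ _) (subsetsOf S))

  𝔼-cong : (S : VSet N) {Φ Ψ : VSet N → ℚ} → (∀ W → W ⊆ S → Φ W ≡ Ψ W) → 𝔼 S Φ ≡ 𝔼 S Ψ
  𝔼-cong S Φ≗Ψ = sumℚ-map-cong (All.map (λ {W} W⊆S → cong (_* weight S W) (Φ≗Ψ W W⊆S)) (subsetsOf-⊆ S))

  𝔼-+ : (S : VSet N) (Φ Ψ : VSet N → ℚ) → 𝔼 S (λ W → Φ W + Ψ W) ≡ 𝔼 S Φ + 𝔼 S Ψ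
  𝔼-+ S Φ Ψ =
    trans (sumℚ-map-cong (All.universal (λ W → ℚP.*-distribʳ-+ (weight S W) (Φ W) (Ψ W)) (subsetsOf S)))
          (sumℚ-map-+ _ _ (subsetsOf S))

  𝔼-*ˡ : (S : VSet N) (k : ℚ) (Φ : VSet N → ℚ) → 𝔼 S (λ W → k * Φ W) ≡ k * 𝔼 S Φ
  𝔼-*ˡ S k Φ = trans (sumℚ-map-cong (All.universal (λ W → ℚP.*-assoc k (Φ W) (weight S W)) (subsetsOf S)))
                     (sumℚ-map-*ˡ k _ (subsetsOf S))

  𝔼-0 : (S : VSet N) → 𝔼 S (λ _ → 0ℚ) ≡ 0ℚ
  𝔼-0 S = trans (𝔼-*ˡ S 0ℚ (λ _ → 1ℚ)) (ℚP.*-zeroˡ (𝔼 S (λ _ → 1ℚ)))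

  𝔼-minus : (S : VSet N) (Φ Ψ : VSet N → ℚ) → 𝔼 S (λ W → Φ W - Ψ W) ≡ 𝔼 S Φ - 𝔼 S Ψ
  𝔼-minus S Φ Ψ =
    begin
      𝔼 S (λ W → Φ W - Ψ W)
        ≡⟨ 𝔼-cong S (λ W _ → cong (λ y → Φ W + y) (neg-as-scaling (Ψ W))) ⟩
      𝔼 S (λ W → Φ W + (- 1ℚ) * Ψ W)
        ≡⟨ 𝔼-+ S Φ _ ⟩
      𝔼 S Φ + 𝔼 S (λ W → (- 1ℚ) * Ψ W)
        ≡⟨ cong (λ y → 𝔼 S Φ + y) (trans (𝔼-*ˡ S (- 1ℚ) Ψ) (sym (neg-as-scaling _))) ⟩
      𝔼 S Φ - 𝔼 S Ψ
    ∎
    where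
    neg-as-scaling : ∀ x → - x ≡ (- 1ℚ) * x
    neg-as-scaling = solve 1 (λ x → :- x := (:- con 1ℚ) :* x) refl

  𝔼-sum : ∀ {m} (S : VSet N) (f : Fin m → VSet N → ℚ) →
          𝔼 S (λ W → ℚΣ.sum (λ z → f z W)) ≡ ℚΣ.sum (λ z → 𝔼 S (f z))
  𝔼-sum {m = zero} S f = 𝔼-0 S
  𝔼-sum {m = suc m} S f = trans (𝔼-+ S (f zero) _) (cong (λ y → 𝔼 S (f zero) + y) (𝔼-sum S (f ∘ suc)))

  𝔼-step-in : (S : VSet (suc N)) (Φ : VSet (suc N) → ℚ) → S zero ≡ true →
    𝔼 S Φ ≡ (1ℚ - q) * 𝔼 (S ∘ suc) (Φ ∘ consB true) + q * 𝔼 (S ∘ suc) (Φ ∘ consB false)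
  𝔼-step-in {N} S Φ S0 =
    begin
      sumℚ (map term (subsetsOf S))
        ≡⟨ cong (sumℚ ∘ map term) subsetsOf-in ⟩
      sumℚ (map term (map (consB true) R ++ map (consB false) R))
        ≡⟨ cong sumℚ (map-++ term (map (consB true) R) _) ⟩
      sumℚ (map term (map (consB true) R) ++ map term (map (consB false) R))
        ≡⟨ sumℚ-++ (map term (map (consB true) R)) _ ⟩
      sumℚ (map term (map (consB true) R)) + sumℚ (map term (map (consB false) R))
        ≡⟨ cong₂ _+_ (cong sumℚ (sym (map-∘ R))) (cong sumℚ (sym (map-∘ R))) ⟩
      sumℚ (map (term ∘ consB true) R) + sumℚ (map (term ∘ consB false) R)
        ≡⟨ cong₂ _+_ (trans (sumℚ-map-cong (All.universal survives R)) (sumℚ-map-*ˡ (1ℚ - q) _ R))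
                     (trans (sumℚ-map-cong (All.universal fails R)) (sumℚ-map-*ˡ q _ R)) ⟩
      (1ℚ - q) * 𝔼 (S ∘ suc) (Φ ∘ consB true) + q * 𝔼 (S ∘ suc) (Φ ∘ consB false)
    ∎
    where
    R : List (VSet N)
    R = subsetsOf (S ∘ suc)
    term : VSet (suc N) → ℚ
    term W = Φ W * weight S W
    subsetsOf-in : subsetsOf S ≡ map (consB true) R ++ map (consB false) R
    subsetsOf-in rewrite S0 = refl
    powers : VSet N → ℚ × ℚ
    powers W = q ^ℚ countF (λ v → S (suc v) ∧ not (W v)) , (1ℚ - q) ^ℚ countF W
    in-weight : ∀ Φ p r q → Φ * (p * ((1ℚ - q) * r)) ≡ (1ℚ - q) * (Φ * (p * r))
    in-weight = solve 4 (λ Φ p r q → Φ :* (p :* ((con 1ℚ :- q) :* r)) := (con 1ℚ :- q) :* (Φ :* (p :* r))) refl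
    out-weight : ∀ Φ p r q → Φ * ((q * p) * r) ≡ q * (Φ * (p * r))
    out-weight = solve 4 (λ Φ p r q → Φ :* ((q :* p) :* r) := q :* (Φ :* (p :* r))) refl
    survives : ∀ W → term (consB true W) ≡ (1ℚ - q) * (Φ (consB true W) * weight (S ∘ suc) W)
    survives W rewrite S0 = in-weight (Φ (consB true W)) (proj₁ (powers W)) (proj₂ (powers W)) q
    fails : ∀ W → term (consB false W) ≡ q * (Φ (consB false W) * weight (S ∘ suc) W)
    fails W rewrite S0 = out-weight (Φ (consB false W)) (proj₁ (powers W)) (proj₂ (powers W)) q

  𝔼-step-skip : (S : VSet (suc N)) (Φ : VSet (suc N) → ℚ) → S zero ≡ false →
    𝔼 S Φ ≡ 𝔼 (S ∘ suc) (Φ ∘ consB false)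
  𝔼-step-skip {N} S Φ S0 =
    trans (cong (sumℚ ∘ map term) subsetsOf-out)
          (trans (cong sumℚ (sym (map-∘ R))) (sumℚ-map-cong (All.universal skip R)))
    where
    R : List (VSet N)
    R = subsetsOf (S ∘ suc)
    term : VSet (suc N) → ℚ
    term W = Φ W * weight S W
    subsetsOf-out : subsetsOf S ≡ map (consB false) R
    subsetsOf-out rewrite S0 = refl
    skip : ∀ W → term (consB false W) ≡ Φ (consB false W) * weight (S ∘ suc) W
    skip W rewrite S0 = refl

  𝔼-misses-contains : (S A C : VSet N) → A ⊆ S → C ⊆ S → (∀ x → A x ≡ true → C x ≡ false) →
    𝔼 S (λ W → 𝟙 (misses A W ∧ contains C W)) ≡ (q ^ℚ countF A) * ((1ℚ - q) ^ℚ countF C)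
  𝔼-misses-contains {zero} _ _ _ _ _ _ = refl
  𝔼-misses-contains {suc N} S A C A⊆S C⊆S disjoint = by-cases (S zero) (A zero) (C zero) refl refl refl
    where
    S′ : VSet N
    S′ = S ∘ suc
    event : VSet (suc N) → ℚ
    event W = 𝟙 (misses A W ∧ contains C W)
    event′ : VSet N → ℚ
    event′ W = 𝟙 (misses (A ∘ suc) W ∧ contains (C ∘ suc) W)
    a′ c′ : ℚ
    a′ = q ^ℚ countF (A ∘ suc)
    c′ = (1ℚ - q) ^ℚ countF (C ∘ suc)
    IH : 𝔼 S′ event′ ≡ a′ * c′
    IH = 𝔼-misses-contains S′ (A ∘ suc) (C ∘ suc) (A⊆S ∘ suc) (C⊆S ∘ suc) (disjoint ∘ suc)
    by-cases : ∀ s a c → S zero ≡ s → A zero ≡ a → C zero ≡ c →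
      𝔼 S event ≡ (q ^ℚ (𝕀 a ℕ.+ countF (A ∘ suc))) * ((1ℚ - q) ^ℚ (𝕀 c ℕ.+ countF (C ∘ suc)))
    by-cases _ true true _ A0 C0 with () ← trans (sym (disjoint zero A0)) C0
    by-cases false true _ S0 A0 _ with () ← trans (sym (A⊆S zero A0)) S0
    by-cases false _ true S0 _ C0 with () ← trans (sym (C⊆S zero C0)) S0
    by-cases true true false S0 A0 C0 =
      begin
        𝔼 S event                                                      ≡⟨ 𝔼-step-in S event S0 ⟩
        (1ℚ - q) * 𝔼 S′ (event ∘ consB true) + q * 𝔼 S′ (event ∘ consB false)
          ≡⟨ cong₂ (λ x y → (1ℚ - q) * x + q * y) (trans (𝔼-cong S′ (λ W _ → killed W)) (𝔼-0 S′))
                                                  (trans (𝔼-cong S′ (λ W _ → kept W)) IH) ⟩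
        (1ℚ - q) * 0ℚ + q * (a′ * c′)                                  ≡⟨ regroup q a′ c′ ⟩
        (q * a′) * c′
      ∎
      where
      killed : ∀ W → event (consB true W) ≡ 0ℚ
      killed W rewrite A0 = refl
      kept : ∀ W → event (consB false W) ≡ event′ W
      kept W rewrite A0 | C0 = refl
      regroup : ∀ q x y → (1ℚ - q) * 0ℚ + q * (x * y) ≡ (q * x) * y
      regroup = solve 3 (λ q x y → (con 1ℚ :- q) :* con 0ℚ :+ q :* (x :* y) := (q :* x) :* y) refl
    by-cases true false true S0 A0 C0 =
      begin
        𝔼 S event                                                      ≡⟨ 𝔼-step-in S event S0 ⟩
        (1ℚ - q) * 𝔼 S′ (event ∘ consB true) + q * 𝔼 S′ (event ∘ consB false)
          ≡⟨ cong₂ (λ x y → (1ℚ - q) * x + q * y) (trans (𝔼-cong S′ (λ W _ → kept W)) IH)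
                                                  (trans (𝔼-cong S′ (λ W _ → killed W)) (𝔼-0 S′)) ⟩
        (1ℚ - q) * (a′ * c′) + q * 0ℚ                                  ≡⟨ regroup q a′ c′ ⟩
        a′ * ((1ℚ - q) * c′)
      ∎
      where
      kept : ∀ W → event (consB true W) ≡ event′ W
      kept W rewrite A0 | C0 = refl
      killed : ∀ W → event (consB false W) ≡ 0ℚ
      killed W rewrite A0 | C0 = cong 𝟙 (∧-zeroʳ (misses (A ∘ suc) W))
      regroup : ∀ q x y → (1ℚ - q) * (x * y) + q * 0ℚ ≡ x * ((1ℚ - q) * y)
      regroup = solve 3 (λ q x y → (con 1ℚ :- q) :* (x :* y) :+ q :* con 0ℚ := x :* ((con 1ℚ :- q) :* y)) refl
    by-cases true false false S0 A0 C0 =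
      begin
        𝔼 S event                                                      ≡⟨ 𝔼-step-in S event S0 ⟩
        (1ℚ - q) * 𝔼 S′ (event ∘ consB true) + q * 𝔼 S′ (event ∘ consB false)
          ≡⟨ cong₂ (λ x y → (1ℚ - q) * x + q * y) (trans (𝔼-cong S′ (λ W _ → kept W)) IH)
                                                  (trans (𝔼-cong S′ (λ W _ → kept W)) IH) ⟩
        (1ℚ - q) * (a′ * c′) + q * (a′ * c′)                          ≡⟨ regroup q (a′ * c′) ⟩
        a′ * c′
      ∎
      where
      kept : ∀ {b} W → event (consB b W) ≡ event′ W
      kept W rewrite A0 | C0 = refl
      regroup : ∀ q x → (1ℚ - q) * x + q * x ≡ x
      regroup = solve 2 (λ q x → (con 1ℚ :- q) :* x :+ q :* x := x) refl
    by-cases false false false S0 A0 C0 =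
      trans (𝔼-step-skip S event S0) (trans (𝔼-cong S′ (λ W _ → kept W)) IH)
      where
      kept : ∀ W → event (consB false W) ≡ event′ W
      kept W rewrite A0 | C0 = refl

  private
    ∅ : VSet N
    ∅ _ = false

    ∅⊆ : (S : VSet N) → ∅ ⊆ S
    ∅⊆ S _ ()

    countF-∅ : countF (∅ {N}) ≡ 0
    countF-∅ {N} = countF-none {p = ∅ {N}} (λ _ → refl)

    misses-∅ : (W : VSet N) → misses ∅ W ≡ true
    misses-∅ {N} W = cong not (anyF-none {p = λ x → ∅ {N} x ∧ W x} (λ _ → refl))

    contains-⁅⁆ : (a : Fin N) (W : VSet N) → contains ⁅ a ⁆ W ≡ W a
    contains-⁅⁆ a W with W a in Wa
    ... | true = cong not (trans (anyF-⁅⁆ a (not ∘ W)) (cong not Wa))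
    ... | false = cong not (trans (anyF-⁅⁆ a (not ∘ W)) (cong not Wa))

    ⁅⁆⊆ : (S : VSet N) {a : Fin N} → S a ≡ true → ⁅ a ⁆ ⊆ S
    ⁅⁆⊆ S Sa x x≡a rewrite ≟-true x≡a = Sa

  𝔼-misses : (S A : VSet N) → A ⊆ S → 𝔼 S (𝟙 ∘ misses A) ≡ q ^ℚ countF A
  𝔼-misses {N} S A A⊆S =
    begin
      𝔼 S (𝟙 ∘ misses A)
        ≡⟨ 𝔼-cong S (λ W _ → sym (no-condition W)) ⟩
      𝔼 S (λ W → 𝟙 (misses A W ∧ contains ∅ W))
        ≡⟨ 𝔼-misses-contains S A ∅ A⊆S (∅⊆ S) (λ _ _ → refl) ⟩
      (q ^ℚ countF A) * ((1ℚ - q) ^ℚ countF (∅ {N}))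
        ≡⟨ cong (λ c → (q ^ℚ countF A) * ((1ℚ - q) ^ℚ c)) (countF-∅ {N}) ⟩
      (q ^ℚ countF A) * 1ℚ
        ≡⟨ ℚP.*-identityʳ _ ⟩
      q ^ℚ countF A
    ∎
    where
    no-condition : ∀ W → 𝟙 (misses A W ∧ contains ∅ W) ≡ 𝟙 (misses A W)
    no-condition W =
      trans (cong (λ b → 𝟙 (misses A W ∧ b)) (misses-∅ (not ∘ W))) (cong 𝟙 (∧-identityʳ (misses A W)))

  𝔼-1 : (S : VSet N) → 𝔼 S (λ _ → 1ℚ) ≡ 1ℚ
  𝔼-1 {N} S =
    trans (𝔼-cong S (λ W _ → cong 𝟙 (sym (misses-∅ W))))
          (trans (𝔼-misses S ∅ (∅⊆ S)) (cong (q ^ℚ_) (countF-∅ {N})))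

  𝔼-hits : (S A : VSet N) → A ⊆ S → 𝔼 S (𝟙 ∘ hits A) ≡ 1ℚ - q ^ℚ countF A
  𝔼-hits S A A⊆S =
    begin
      𝔼 S (𝟙 ∘ hits A)                       ≡⟨ 𝔼-cong S (λ W _ → complement (hits A W)) ⟩
      𝔼 S (λ W → 1ℚ - 𝟙 (misses A W))        ≡⟨ 𝔼-minus S (λ _ → 1ℚ) (𝟙 ∘ misses A) ⟩
      𝔼 S (λ _ → 1ℚ) - 𝔼 S (𝟙 ∘ misses A)    ≡⟨ cong₂ _-_ (𝔼-1 S) (𝔼-misses S A A⊆S) ⟩
      1ℚ - q ^ℚ countF A
    ∎
    where
    complement : ∀ b → 𝟙 b ≡ 1ℚ - 𝟙 (not b)
    complement true = refl
    complement false = refl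

  𝔼-survives : (S : VSet N) (a : Fin N) → S a ≡ true → 𝔼 S (λ W → 𝟙 (W a)) ≡ 1ℚ - q
  𝔼-survives {N} S a Sa =
    begin
      𝔼 S (λ W → 𝟙 (W a))
        ≡⟨ 𝔼-cong S (λ W _ → cong 𝟙 (sym (cong₂ _∧_ (misses-∅ W) (contains-⁅⁆ a W)))) ⟩
      𝔼 S (λ W → 𝟙 (misses ∅ W ∧ contains ⁅ a ⁆ W))
        ≡⟨ 𝔼-misses-contains S ∅ ⁅ a ⁆ (∅⊆ S) (⁅⁆⊆ S Sa) (λ _ ()) ⟩
      (q ^ℚ countF (∅ {N})) * ((1ℚ - q) ^ℚ countF ⁅ a ⁆)
        ≡⟨ cong₂ (λ a c → (q ^ℚ a) * ((1ℚ - q) ^ℚ c)) (countF-∅ {N}) (countF-⁅⁆ a) ⟩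
      1ℚ * ((1ℚ - q) * 1ℚ)
        ≡⟨ trans (ℚP.*-identityˡ _) (ℚP.*-identityʳ _) ⟩
      1ℚ - q
    ∎

  𝔼-survives-hits : (S B : VSet N) (a : Fin N) → S a ≡ true → B ⊆ S → B a ≡ false →
    𝔼 S (λ W → 𝟙 (W a ∧ hits B W)) ≡ (1ℚ - q) * (1ℚ - q ^ℚ countF B)
  𝔼-survives-hits S B a Sa B⊆S Ba =
    begin
      𝔼 S (λ W → 𝟙 (W a ∧ hits B W))
        ≡⟨ 𝔼-cong S (λ W _ → split W) ⟩
      𝔼 S (λ W → 𝟙 (W a) - 𝟙 (misses B W ∧ contains ⁅ a ⁆ W))
        ≡⟨ 𝔼-minus S (λ W → 𝟙 (W a)) (λ W → 𝟙 (misses B W ∧ contains ⁅ a ⁆ W)) ⟩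
      𝔼 S (λ W → 𝟙 (W a)) - 𝔼 S (λ W → 𝟙 (misses B W ∧ contains ⁅ a ⁆ W))
        ≡⟨ cong₂ _-_ (𝔼-survives S a Sa) (𝔼-misses-contains S B ⁅ a ⁆ B⊆S (⁅⁆⊆ S Sa) disjoint) ⟩
      (1ℚ - q) - (q ^ℚ countF B) * ((1ℚ - q) ^ℚ countF ⁅ a ⁆)
        ≡⟨ cong (λ c → (1ℚ - q) - (q ^ℚ countF B) * ((1ℚ - q) ^ℚ c)) (countF-⁅⁆ a) ⟩
      (1ℚ - q) - (q ^ℚ countF B) * ((1ℚ - q) * 1ℚ)
        ≡⟨ factor q (q ^ℚ countF B) ⟩
      (1ℚ - q) * (1ℚ - q ^ℚ countF B)
    ∎
    where
    disjoint : ∀ x → B x ≡ true → ⁅ a ⁆ x ≡ false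
    disjoint x Bx with x Fin.≟ a
    ... | no _ = refl
    ... | yes refl with () ← trans (sym Bx) Ba
    split : ∀ W → 𝟙 (W a ∧ hits B W) ≡ 𝟙 (W a) - 𝟙 (misses B W ∧ contains ⁅ a ⁆ W)
    split W rewrite contains-⁅⁆ a W with W a | hits B W
    ... | true | true = refl
    ... | true | false = refl
    ... | false | true = refl
    ... | false | false = refl
    factor : ∀ q x → (1ℚ - q) - x * ((1ℚ - q) * 1ℚ) ≡ (1ℚ - q) * (1ℚ - x)
    factor = solve 2 (λ q x → (con 1ℚ :- q) :- x :* ((con 1ℚ :- q) :* con 1ℚ) := (con 1ℚ :- q) :* (con 1ℚ :- x))
                     refl

private
  toℚᵘ-ℤtoℚ : ∀ z → toℚᵘ (ℤtoℚ z) ℚᵘ.≃ ℚᵘ.mkℚᵘ z 0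
  toℚᵘ-ℤtoℚ z = ℚP.toℚᵘ-fromℚᵘ (ℚᵘ.mkℚᵘ z 0)

ℤtoℚ-+ : ∀ a b → ℤtoℚ (a ℤ.+ b) ≡ ℤtoℚ a + ℤtoℚ b
ℤtoℚ-+ a b = ℚP.toℚᵘ-injective (begin
    toℚᵘ (ℤtoℚ (a ℤ.+ b))               ≈⟨ toℚᵘ-ℤtoℚ (a ℤ.+ b) ⟩
    ℚᵘ.mkℚᵘ (a ℤ.+ b) 0                  ≈⟨ ℚᵘ.*≡* (cross a b) ⟩
    ℚᵘ.mkℚᵘ a 0 ℚᵘ.+ ℚᵘ.mkℚᵘ b 0        ≈⟨ ℚᵘP.+-cong (toℚᵘ-ℤtoℚ a) (toℚᵘ-ℤtoℚ b) ⟨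
    toℚᵘ (ℤtoℚ a) ℚᵘ.+ toℚᵘ (ℤtoℚ b)    ≈⟨ ℚP.toℚᵘ-homo-+ (ℤtoℚ a) (ℤtoℚ b) ⟨
    toℚᵘ (ℤtoℚ a + ℤtoℚ b)              ∎)
  where
  open ℚᵘP.≃-Reasoning
  cross : ∀ a b → (a ℤ.+ b) ℤ.* (+ 1 ℤ.* + 1) ≡ (a ℤ.* + 1 ℤ.+ b ℤ.* + 1) ℤ.* + 1
  cross = solve-∀

ℤtoℚ-neg : ∀ a → ℤtoℚ (ℤ.- a) ≡ - ℤtoℚ a
ℤtoℚ-neg a = ℚP.toℚᵘ-injective (begin
    toℚᵘ (ℤtoℚ (ℤ.- a))    ≈⟨ toℚᵘ-ℤtoℚ (ℤ.- a) ⟩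
    ℚᵘ.mkℚᵘ (ℤ.- a) 0       ≈⟨ ℚᵘP.-‿cong (toℚᵘ-ℤtoℚ a) ⟨
    ℚᵘ.- toℚᵘ (ℤtoℚ a)      ≈⟨ ℚP.toℚᵘ-homo‿- (ℤtoℚ a) ⟨
    toℚᵘ (- ℤtoℚ a)         ∎)
  where
  open ℚᵘP.≃-Reasoning

ℕtoℚ-countF : (p : Fin N → Bool) → ℕtoℚ (countF p) ≡ ℚΣ.sum (λ z → 𝟙 (p z))
ℕtoℚ-countF {zero} p = refl
ℕtoℚ-countF {suc N} p =
  trans (ℤtoℚ-+ (+ 𝕀 (p zero)) (+ countF (p ∘ suc))) (cong₂ _+_ (indicator (p zero)) (ℕtoℚ-countF (p ∘ suc)))
  where
  indicator : ∀ b → ℕtoℚ (𝕀 b) ≡ 𝟙 b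
  indicator true = refl
  indicator false = refl

X^_ : ℕ → ℕ → ℤ
(X^ k) j = if j ℕ.≡ᵇ k then + 1 else + 0

1-X^_ : ℕ → ℕ → ℤ
(1-X^ k) j = (X^ 0) j ℤ.- (X^ k) j

when : Bool → (ℕ → ℤ) → ℕ → ℤ
when b p j = if b then p j else + 0

leafPoly : ℕ → ℕ → ℤ
leafPoly b j = (1-X^ 1) j ℤ.- (X^ b) j ℤ.+ (X^ suc b) j

X^-diag : ∀ k → (X^ k) k ≡ + 1
X^-diag zero = refl
X^-diag (suc k) = X^-diag k

X^-off : ∀ {k j} → j ≢ k → (X^ k) j ≡ + 0
X^-off {zero} {zero} j≢k = ⊥-elim (j≢k refl)
X^-off {zero} {suc j} _ = refl
X^-off {suc k} {zero} _ = refl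
X^-off {suc k} {suc j} j≢k = X^-off (j≢k ∘ cong suc)

module _ (q : ℚ) where

  open ≡-Reasoning

  polyEval-cong : ∀ {a b} d → (∀ j → j ℕ.≤ d → a j ≡ b j) → polyEval a d q ≡ polyEval b d q
  polyEval-cong zero a≗b = cong ℤtoℚ (a≗b 0 z≤n)
  polyEval-cong (suc d) a≗b =
    cong₂ (λ x y → x + ℤtoℚ y * (q ^ℚ suc d))
          (polyEval-cong d (λ j j≤d → a≗b j (ℕP.m≤n⇒m≤1+n j≤d))) (a≗b (suc d) ℕP.≤-refl)

  polyEval-0 : ∀ d → polyEval (λ _ → + 0) d q ≡ 0ℚ
  polyEval-0 zero = refl
  polyEval-0 (suc d) = trans (cong (λ x → x + 0ℚ * (q ^ℚ suc d)) (polyEval-0 d))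
                             (trans (ℚP.+-identityˡ _) (ℚP.*-zeroˡ (q ^ℚ suc d)))

  polyEval-+ : ∀ a b d → polyEval (λ j → a j ℤ.+ b j) d q ≡ polyEval a d q + polyEval b d q
  polyEval-+ a b zero = ℤtoℚ-+ (a 0) (b 0)
  polyEval-+ a b (suc d) =
    begin
      polyEval (λ j → a j ℤ.+ b j) d q + ℤtoℚ (a (suc d) ℤ.+ b (suc d)) * qᵈ
        ≡⟨ cong₂ (λ x y → x + y * qᵈ) (polyEval-+ a b d) (ℤtoℚ-+ (a (suc d)) (b (suc d))) ⟩
      (polyEval a d q + polyEval b d q) + (ℤtoℚ (a (suc d)) + ℤtoℚ (b (suc d))) * qᵈ
        ≡⟨ regroup (polyEval a d q) (polyEval b d q) (ℤtoℚ (a (suc d))) (ℤtoℚ (b (suc d))) qᵈ ⟩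
      (polyEval a d q + ℤtoℚ (a (suc d)) * qᵈ) + (polyEval b d q + ℤtoℚ (b (suc d)) * qᵈ)
    ∎
    where
    qᵈ : ℚ
    qᵈ = q ^ℚ suc d
    regroup : ∀ x y u v w → (x + y) + (u + v) * w ≡ (x + u * w) + (y + v * w)
    regroup = solve 5 (λ x y u v w → (x :+ y) :+ (u :+ v) :* w := (x :+ u :* w) :+ (y :+ v :* w)) refl

  polyEval-neg : ∀ a d → polyEval (λ j → ℤ.- a j) d q ≡ - polyEval a d q
  polyEval-neg a zero = ℤtoℚ-neg (a 0)
  polyEval-neg a (suc d) =
    trans (cong₂ (λ x y → x + y * (q ^ℚ suc d)) (polyEval-neg a d) (ℤtoℚ-neg (a (suc d))))
          (negate-sum (polyEval a d q) (ℤtoℚ (a (suc d))) (q ^ℚ suc d))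
    where
    negate-sum : ∀ x y z → - x + (- y) * z ≡ - (x + y * z)
    negate-sum = solve 3 (λ x y z → :- x :+ (:- y) :* z := :- (x :+ y :* z)) refl

  polyEval-minus : ∀ a b d → polyEval (λ j → a j ℤ.- b j) d q ≡ polyEval a d q - polyEval b d q
  polyEval-minus a b d = trans (polyEval-+ a (λ j → ℤ.- b j) d) (cong (λ y → polyEval a d q + y) (polyEval-neg b d))

  polyEval-sum : ∀ {m} (c : Fin m → ℕ → ℤ) d →
                 ℚΣ.sum (λ z → polyEval (c z) d q) ≡ polyEval (λ j → ℤΣ.sum (λ z → c z j)) d q
  polyEval-sum {zero} c d = sym (polyEval-0 d)
  polyEval-sum {suc m} c d =
    trans (cong (λ x → polyEval (c zero) d q + x) (polyEval-sum (c ∘ suc) d))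
          (sym (polyEval-+ (c zero) (λ j → ℤΣ.sum (λ z → c (suc z) j)) d))

  polyEval-X^ : ∀ {k} d → k ℕ.≤ d → polyEval (X^ k) d q ≡ q ^ℚ k
  polyEval-X^ {zero} zero _ = refl
  polyEval-X^ {k} (suc d) k≤1+d with ℕP.m≤n⇒m<n∨m≡n k≤1+d
  ... | inj₁ k<1+d =
    begin
      polyEval (X^ k) d q + ℤtoℚ ((X^ k) (suc d)) * (q ^ℚ suc d)
        ≡⟨ cong₂ (λ x y → x + ℤtoℚ y * (q ^ℚ suc d))
                 (polyEval-X^ d (ℕP.≤-pred k<1+d)) (X^-off (ℕP.<⇒≢ k<1+d ∘ sym)) ⟩
      q ^ℚ k + 0ℚ * (q ^ℚ suc d)
        ≡⟨ trans (cong (λ y → q ^ℚ k + y) (ℚP.*-zeroˡ (q ^ℚ suc d))) (ℚP.+-identityʳ _) ⟩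
      q ^ℚ k
    ∎
  ... | inj₂ refl =
    begin
      polyEval (X^ (suc d)) d q + ℤtoℚ ((X^ suc d) (suc d)) * (q ^ℚ suc d)
        ≡⟨ cong₂ (λ x y → x + ℤtoℚ y * (q ^ℚ suc d))
                 (trans (polyEval-cong d (λ j j≤d → X^-off (ℕP.<⇒≢ (s≤s j≤d)))) (polyEval-0 d))
                 (X^-diag (suc d)) ⟩
      0ℚ + 1ℚ * (q ^ℚ suc d)
        ≡⟨ trans (ℚP.+-identityˡ _) (ℚP.*-identityˡ _) ⟩
      q ^ℚ suc d
    ∎

  polyEval-1-X^ : ∀ {k} d → k ℕ.≤ d → polyEval (1-X^ k) d q ≡ 1ℚ - q ^ℚ k
  polyEval-1-X^ d k≤d = trans (polyEval-minus (X^ 0) (X^ _) d) (cong₂ _-_ (polyEval-X^ d z≤n) (polyEval-X^ d k≤d))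

  polyEval-leafPoly : ∀ {b} d → suc b ℕ.≤ d → polyEval (leafPoly b) d q ≡ (1ℚ - q) * (1ℚ - q ^ℚ b)
  polyEval-leafPoly {b} d b<d =
    begin
      polyEval (leafPoly b) d q
        ≡⟨ trans (polyEval-+ _ (X^ suc b) d) (cong (_+ polyEval (X^ suc b) d q) (polyEval-minus (1-X^ 1) (X^ b) d)) ⟩
      polyEval (1-X^ 1) d q - polyEval (X^ b) d q + polyEval (X^ suc b) d q
        ≡⟨ cong₂ (λ x y → x - y + polyEval (X^ suc b) d q)
                 (polyEval-1-X^ d (ℕP.≤-trans (s≤s z≤n) b<d)) (polyEval-X^ d (ℕP.<⇒≤ b<d)) ⟩
      (1ℚ - q ^ℚ 1) - q ^ℚ b + polyEval (X^ suc b) d q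
        ≡⟨ cong (λ x → (1ℚ - q ^ℚ 1) - q ^ℚ b + x) (polyEval-X^ d b<d) ⟩
      (1ℚ - q * 1ℚ) - q ^ℚ b + q * q ^ℚ b
        ≡⟨ factor q (q ^ℚ b) ⟩
      (1ℚ - q) * (1ℚ - q ^ℚ b)
    ∎
    where
    factor : ∀ q x → (1ℚ - q * 1ℚ) - x + q * x ≡ (1ℚ - q) * (1ℚ - x)
    factor = solve 2 (λ q x → (con 1ℚ :- q :* con 1ℚ) :- x :+ q :* x := (con 1ℚ :- q) :* (con 1ℚ :- x)) refl

record Finite (A : Set) : Set where
  field
    size : ℕ
    enum : Fin size ↔ A

  element : Fin size → A
  element = Inverse.to enum

  index : A → Fin size
  index = Inverse.from enum

  element-index : ∀ a → element (index a) ≡ a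
  element-index = Inverse.strictlyInverseˡ enum

  index-element : ∀ i → index (element i) ≡ i
  index-element = Inverse.strictlyInverseʳ enum

  index-injective : ∀ {a b} → index a ≡ index b → a ≡ b
  index-injective {a} {b} e = trans (sym (element-index a)) (trans (cong element e) (element-index b))

module _ where

  open Finite

  finite-Fin : ∀ k → Finite (Fin k)
  finite-Fin k = record { size = k ; enum = ↔-refl }

  finite-Bool : Finite Bool
  finite-Bool = record { size = 2 ; enum = 2↔Bool }

  _⊎ᶠ_ : Finite A → Finite A′ → Finite (A ⊎ A′)
  FA ⊎ᶠ FB = record { size = size FA ℕ.+ size FB ; enum = mk↔ₛ′ to from to-from from-to }
    where
    to : Fin (size FA ℕ.+ size FB) → _
    to i = Sum.map (element FA) (element FB) (splitAt (size FA) i)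
    from : _ → Fin (size FA ℕ.+ size FB)
    from = join (size FA) (size FB) ∘ Sum.map (index FA) (index FB)
    to-from : ∀ x → to (from x) ≡ x
    to-from (inj₁ a) rewrite splitAt-↑ˡ (size FA) (index FA a) (size FB) = cong inj₁ (element-index FA a)
    to-from (inj₂ b) rewrite splitAt-↑ʳ (size FA) (size FB) (index FB b) = cong inj₂ (element-index FB b)
    from-to : ∀ i → from (to i) ≡ i
    from-to i with splitAt (size FA) i in split
    ... | inj₁ j = trans (cong (_↑ˡ size FB) (index-element FA j))
                         (trans (cong (join (size FA) (size FB)) (sym split)) (join-splitAt (size FA) (size FB) i))
    ... | inj₂ j = trans (cong (size FA ↑ʳ_) (index-element FB j))
                         (trans (cong (join (size FA) (size FB)) (sym split)) (join-splitAt (size FA) (size FB) i))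

  _×ᶠ_ : Finite A → Finite A′ → Finite (A × A′)
  FA ×ᶠ FB = record { size = size FA ℕ.* size FB ; enum = mk↔ₛ′ to from to-from from-to }
    where
    to : Fin (size FA ℕ.* size FB) → _
    to i = Product.map (element FA) (element FB) (remQuot (size FB) i)
    from : _ → Fin (size FA ℕ.* size FB)
    from (a , b) = combine (index FA a) (index FB b)
    to-from : ∀ x → to (from x) ≡ x
    to-from (a , b) = trans (cong (Product.map (element FA) (element FB)) (remQuot-combine (index FA a) (index FB b)))
                            (cong₂ _,_ (element-index FA a) (element-index FB b))
    from-to : ∀ i → from (to i) ≡ i
    from-to i = trans (cong₂ combine (index-element FA _) (index-element FB _)) (combine-remQuot {size FA} (size FB) i)

  module FiniteSum {c ℓ : Level} (M : CommutativeMonoid c ℓ) where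

    open CommutativeMonoid M
      using (Carrier; _≈_; _∙_; ∙-cong; assoc; identityʳ; identityˡ; reflexive)
      renaming (refl to ≈-refl; sym to ≈-sym; trans to ≈-trans)
    open import Algebra.Properties.CommutativeMonoid.Sum M using (sum; sum-cong-≋)

    ∑ : Finite A → (A → Carrier) → Carrier
    ∑ FA f = sum (f ∘ element FA)

    ∑-cong : (FA : Finite A) {f g : A → Carrier} → (∀ a → f a ≈ g a) → ∑ FA f ≈ ∑ FA g
    ∑-cong FA f≈g = sum-cong-≋ (f≈g ∘ element FA)

    sum-↑ : ∀ m {n} (g : Fin (m ℕ.+ n) → Carrier) → sum g ≈ sum (g ∘ (_↑ˡ n)) ∙ sum (g ∘ (m ↑ʳ_))
    sum-↑ zero g = ≈-sym (identityˡ _)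
    sum-↑ (suc m) g = ≈-trans (∙-cong ≈-refl (sum-↑ m (g ∘ suc))) (≈-sym (assoc _ _ _))

    sum-combine : ∀ m n (g : Fin (m ℕ.* n) → Carrier) → sum g ≈ sum (λ i → sum (λ j → g (combine {m} {n} i j)))
    sum-combine zero n g = ≈-refl
    sum-combine (suc m) n g = ≈-trans (sum-↑ n g) (∙-cong ≈-refl (sum-combine m n (g ∘ (n ↑ʳ_))))

    ∑-⊎ : (FA : Finite A) (FB : Finite A′) (f : A ⊎ A′ → Carrier) →
          ∑ (FA ⊎ᶠ FB) f ≈ ∑ FA (f ∘ inj₁) ∙ ∑ FB (f ∘ inj₂)
    ∑-⊎ FA FB f = ≈-trans (sum-↑ (size FA) _) (∙-cong (sum-cong-≋ left) (sum-cong-≋ right))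
      where
      left : ∀ i → f (element (FA ⊎ᶠ FB) (i ↑ˡ size FB)) ≈ f (inj₁ (element FA i))
      left i rewrite splitAt-↑ˡ (size FA) i (size FB) = ≈-refl
      right : ∀ i → f (element (FA ⊎ᶠ FB) (size FA ↑ʳ i)) ≈ f (inj₂ (element FB i))
      right i rewrite splitAt-↑ʳ (size FA) (size FB) i = ≈-refl

    ∑-× : (FA : Finite A) (FB : Finite A′) (f : A × A′ → Carrier) →
          ∑ (FA ×ᶠ FB) f ≈ ∑ FA (λ a → ∑ FB (λ b → f (a , b)))
    ∑-× FA FB f = ≈-trans (sum-combine (size FA) (size FB) _) (sum-cong-≋ (λ i → sum-cong-≋ (λ j → pair i j)))
      where
      pair : ∀ i j → f (element (FA ×ᶠ FB) (combine i j)) ≈ f (element FA i , element FB j)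
      pair i j = reflexive (cong (f ∘ Product.map (element FA) (element FB)) (remQuot-combine {size FA} {size FB} i j))

    ∑-Bool : (f : Bool → Carrier) → ∑ finite-Bool f ≈ f false ∙ f true
    ∑-Bool f = ∙-cong ≈-refl (identityʳ (f true))

upTo : VSet N → Fin N → VSet N
upTo S v x = S x ∧ ⌊ x Fin.≤? v ⌋

below : VSet N → Fin N → VSet N
below S v x = S x ∧ ⌊ x Fin.<? v ⌋

rank : VSet N → Fin N → ℕ
rank S v = countF (upTo S v)

upTo-⊆ : (S : VSet N) (v : Fin N) → upTo S v ⊆ S
upTo-⊆ S v x e = proj₁ (∧-true e)

below-⊆ : (S : VSet N) (v : Fin N) → below S v ⊆ S
below-⊆ S v x e = proj₁ (∧-true e)

below-irrefl : (S : VSet N) (v : Fin N) → below S v v ≡ false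
below-irrefl S v with v Fin.<? v
... | yes v<v = ⊥-elim (FinP.<-irrefl refl v<v)
... | no _ = ∧-zeroʳ (S v)

≤?-refl : (x : Fin N) → ⌊ x Fin.≤? x ⌋ ≡ true
≤?-refl x with x Fin.≤? x
... | yes _ = refl
... | no x≰x = ⊥-elim (x≰x FinP.≤-refl)

≤?≡<? : {x v : Fin N} → x ≢ v → ⌊ x Fin.≤? v ⌋ ≡ ⌊ x Fin.<? v ⌋
≤?≡<? {x = x} {v} x≢v with x Fin.≤? v | x Fin.<? v
... | yes _ | yes _ = refl
... | no _ | no _ = refl
... | yes x≤v | no x≮v = ⊥-elim (x≮v (FinP.≤∧≢⇒< x≤v x≢v))
... | no x≰v | yes x<v = ⊥-elim (x≰v (ℕP.<⇒≤ x<v))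

≤?-suc : (x v : Fin N) → ⌊ suc x Fin.≤? suc v ⌋ ≡ ⌊ x Fin.≤? v ⌋
≤?-suc x v with x Fin.≤? v | suc x Fin.≤? suc v
... | yes _ | yes _ = refl
... | no _ | no _ = refl
... | yes x≤v | no sx≰sv = ⊥-elim (sx≰sv (s≤s x≤v))
... | no x≰v | yes (s≤s x≤v) = ⊥-elim (x≰v x≤v)

rank-below : (S : VSet N) {v : Fin N} → S v ≡ true → rank S v ≡ suc (countF (below S v))
rank-below S {v} Sv = trans (countF-cong split) (countF-insert (below S v) v (below-irrefl S v))
  where
  split : ∀ x → upTo S v x ≡ insert v (below S v) x
  split x with x Fin.≟ v
  ... | yes refl rewrite Sv | ≤?-refl x = sym (∨-zeroʳ _)
  ... | no x≢v = trans (cong (S x ∧_) (≤?≡<? x≢v)) (sym (∨-identityʳ _))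

rank≤count : (S : VSet N) (v : Fin N) → rank S v ℕ.≤ countF S
rank≤count S v = countF-mono (upTo-⊆ S v)

rank-zero : (S : VSet (suc N)) → rank S zero ≡ 𝕀 (S zero)
rank-zero S = trans (cong₂ ℕ._+_ (cong 𝕀 (∧-identityʳ (S zero))) (countF-none (λ x → ∧-zeroʳ (S (suc x)))))
                   (ℕP.+-identityʳ _)

rank-suc : (S : VSet (suc N)) (v : Fin N) → rank S (suc v) ≡ 𝕀 (S zero) ℕ.+ rank (S ∘ suc) v
rank-suc S v =
  cong₂ ℕ._+_ (cong 𝕀 (∧-identityʳ (S zero))) (countF-cong (λ x → cong (S (suc x) ∧_) (≤?-suc x v)))

open ℤΣ using (sum; sum-cong-≗)

if-true : ∀ {b} {x y : ℤ} → b ≡ true → (if b then x else y) ≡ x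
if-true refl = refl

if-false : ∀ {b} {x y : ℤ} → b ≡ false → (if b then x else y) ≡ y
if-false refl = refl

sum-zero : ∀ {m} {f : Fin m → ℤ} → (∀ k → f k ≡ + 0) → sum f ≡ + 0
sum-zero {zero} _ = refl
sum-zero {suc m} f≡0 = cong₂ ℤ._+_ (f≡0 zero) (sum-zero (f≡0 ∘ suc))

sum-neg : ∀ {m} (f : Fin m → ℤ) → sum (λ k → ℤ.- f k) ≡ ℤ.- sum f
sum-neg {zero} f = refl
sum-neg {suc m} f =
  trans (cong (λ y → ℤ.- f zero ℤ.+ y) (sum-neg (f ∘ suc))) (sym (ℤP.neg-distrib-+ (f zero) (sum (f ∘ suc))))

sum-first : ∀ M m (x : ℤ) → m ℕ.≤ M → sum {M} (λ i → if toℕ i ℕ.<ᵇ m then x else + 0) ≡ + m ℤ.* x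
sum-first zero zero x _ = sym (ℤP.*-zeroˡ x)
sum-first (suc M) zero x _ = trans (ℤP.+-identityˡ _) (sum-zero {M} (λ _ → refl))
sum-first (suc M) (suc m) x (s≤s m≤M) = trans (cong (λ y → x ℤ.+ y) (sum-first M m x m≤M)) (one-more x (+ m))
  where
  one-more : ∀ x m → x ℤ.+ m ℤ.* x ≡ (+ 1 ℤ.+ m) ℤ.* x
  one-more = solve-∀

sum-rank : (S : VSet N) (F : ℕ → ℤ) →
           sum (λ v → if S v then F (rank S v) else + 0) ≡ sum {countF S} (λ k → F (suc (toℕ k)))
sum-rank {zero} S F = refl
sum-rank {suc N} S F = by-cases (S zero) refl
  where
  open ≡-Reasoning
  S′ : VSet N
  S′ = S ∘ suc
  shifted : ∀ b → S zero ≡ b → ∀ v →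
            (if S′ v then F (rank S (suc v)) else + 0) ≡ (if S′ v then F (𝕀 b ℕ.+ rank S′ v) else + 0)
  shifted b S0 v =
    cong (λ r → if S′ v then F r else + 0) (trans (rank-suc S v) (cong (λ b → 𝕀 b ℕ.+ rank S′ v) S0))
  resize : ∀ b → S zero ≡ b →
           sum {𝕀 b ℕ.+ countF S′} (λ k → F (suc (toℕ k))) ≡ sum {countF S} (λ k → F (suc (toℕ k)))
  resize b S0 = cong (λ m → sum {m} (λ k → F (suc (toℕ k)))) (cong (λ b → 𝕀 b ℕ.+ countF S′) (sym S0))
  by-cases : ∀ b → S zero ≡ b →
             sum (λ v → if S v then F (rank S v) else + 0) ≡ sum {countF S} (λ k → F (suc (toℕ k)))
  by-cases true S0 =
    begin
      (if S zero then F (rank S zero) else + 0) ℤ.+ sum (λ v → if S′ v then F (rank S (suc v)) else + 0)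
        ≡⟨ cong₂ ℤ._+_ (trans (if-true S0) (cong F (trans (rank-zero S) (cong 𝕀 S0))))
                       (sum-cong-≗ (shifted true S0)) ⟩
      F 1 ℤ.+ sum (λ v → if S′ v then F (suc (rank S′ v)) else + 0)
        ≡⟨ cong (λ x → F 1 ℤ.+ x) (sum-rank S′ (F ∘ suc)) ⟩
      sum {suc (countF S′)} (λ k → F (suc (toℕ k)))
        ≡⟨ resize true S0 ⟩
      sum {countF S} (λ k → F (suc (toℕ k)))
    ∎
  by-cases false S0 =
    begin
      (if S zero then F (rank S zero) else + 0) ℤ.+ sum (λ v → if S′ v then F (rank S (suc v)) else + 0)
        ≡⟨ cong₂ ℤ._+_ (if-false S0) (sum-cong-≗ (shifted false S0)) ⟩
      + 0 ℤ.+ sum (λ v → if S′ v then F (rank S′ v) else + 0)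
        ≡⟨ trans (ℤP.+-identityˡ _) (sum-rank S′ F) ⟩
      sum {countF S′} (λ k → F (suc (toℕ k)))
        ≡⟨ resize false S0 ⟩
      sum {countF S} (λ k → F (suc (toℕ k)))
    ∎

sum-X^ : ∀ d (a : ℕ → ℤ) j → j ℕ.< d → sum {d} (λ k → a (toℕ k) ℤ.* (X^ toℕ k) j) ≡ a j
sum-X^ (suc d) a zero _ =
  trans (cong₂ ℤ._+_ (ℤP.*-identityʳ (a 0)) (sum-zero {d} (λ k → ℤP.*-zeroʳ (a (suc (toℕ k))))))
        (ℤP.+-identityʳ (a 0))
sum-X^ (suc d) a (suc j) (s≤s j<d) =
  trans (cong₂ ℤ._+_ (ℤP.*-zeroʳ (a 0)) (sum-X^ d (a ∘ suc) j j<d)) (ℤP.+-identityˡ (a (suc j)))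

sum-X^-beyond : ∀ d (a : ℕ → ℤ) j → d ℕ.≤ j → sum {d} (λ k → a (toℕ k) ℤ.* (X^ toℕ k) j) ≡ + 0
sum-X^-beyond zero a j _ = refl
sum-X^-beyond (suc d) a (suc j) (s≤s d≤j) = cong₂ ℤ._+_ (ℤP.*-zeroʳ (a 0)) (sum-X^-beyond d (a ∘ suc) j d≤j)

sum-X^-upTo : ∀ d (a : ℕ → ℤ) j → a d ≡ + 0 → j ℕ.≤ d →
              sum {d} (λ k → a (toℕ k) ℤ.* (X^ toℕ k) j) ≡ a j
sum-X^-upTo d a j ad≡0 j≤d with ℕP.m≤n⇒m<n∨m≡n j≤d
... | inj₁ j<d = sum-X^ d a j j<d
... | inj₂ refl = trans (sum-X^-beyond j a j ℕP.≤-refl) (sym ad≡0)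

-- The graph G′

freezeSet : VSet N → Fin N → Fin N → VSet N
freezeSet S u s x = S s ∧ (⌊ x Fin.≟ u ⌋ ∨ ⌊ x Fin.≟ s ⌋)

-- A sensor v of rank k offers `slots` copies of each gadget; copy i is used when i < prefixes k
-- (resp. forks k), and the unused copies have no neighbours in G, so they are never observed.
record Multiplicities : Set where
  field
    slots : ℕ
    prefixes : ℕ → ℕ
    forks : ℕ → ℕ

module Construction (G : Graph) (S : VSet (n G)) (μ : Multiplicities) where

  open Multiplicities μ

  Slot : Set
  Slot = Fin (n G) × Fin slots

  _≟ˢ_ : (t t′ : Slot) → Dec (t ≡ t′)
  _≟ˢ_ = ≡-dec Fin._≟_ Fin._≟_

  same : Slot → Slot → Bool
  same t t′ = ⌊ t ≟ˢ t′ ⌋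

  active : (ℕ → ℕ) → Slot → Bool
  active copies (v , i) = S v ∧ (toℕ i ℕ.<ᵇ copies (rank S v))

  -- Vertices are a sum type, so that an enumeration by Fin comes from those of the summands.
  Core : Set
  Core = (Fin (n G) × Fin (n G)) ⊎ (Slot ⊎ (Slot ⊎ Slot))

  pattern freeze u s = inj₁ (u , s)
  pattern prefix t = inj₂ (inj₁ t)
  pattern stem t = inj₂ (inj₂ (inj₁ t))
  pattern guard t = inj₂ (inj₂ (inj₂ t))

  Vertex : Set
  Vertex = Fin (n G) ⊎ (Slot ⊎ (Core × Bool))

  pattern old u = inj₁ u
  pattern leaf t = inj₂ (inj₁ t)
  pattern twin c b = inj₂ (inj₂ (c , b))

  finite-Slot : Finite Slot
  finite-Slot = finite-Fin (n G) ×ᶠ finite-Fin slots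

  finite-Core : Finite Core
  finite-Core = (finite-Fin (n G) ×ᶠ finite-Fin (n G)) ⊎ᶠ (finite-Slot ⊎ᶠ (finite-Slot ⊎ᶠ finite-Slot))

  finite-Vertex : Finite Vertex
  finite-Vertex = finite-Fin (n G) ⊎ᶠ (finite-Slot ⊎ᶠ (finite-Core ×ᶠ finite-Bool))

  open Finite finite-Vertex using (element; index; element-index; index-element; index-injective)

  touches : Core → VSet (n G)
  touches (freeze u s) = freezeSet S u s
  touches (prefix t) x = active prefixes t ∧ upTo S (proj₁ t) x
  touches (stem t) x = active forks t ∧ ⌊ x Fin.≟ proj₁ t ⌋
  touches (guard t) x = active forks t ∧ below S (proj₁ t) x

  joins : Core → Core → Bool
  joins (stem t) (guard t′) = same t t′
  joins (guard t) (stem t′) = same t′ t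
  joins _ _ = false

  holds : Core → Slot → Bool
  holds (stem t) t′ = same t t′
  holds _ _ = false

  adjacent : Vertex → Vertex → Bool
  adjacent (old x) (old y) = adj G x y
  adjacent (old x) (twin c _) = touches c x
  adjacent (twin c _) (old x) = touches c x
  adjacent (twin c _) (twin c′ _) = joins c c′
  adjacent (twin c _) (leaf t) = holds c t
  adjacent (leaf t) (twin c _) = holds c t
  adjacent _ _ = false

  joins-sym : ∀ c c′ → joins c c′ ≡ joins c′ c
  joins-sym (freeze _ _) (freeze _ _) = refl
  joins-sym (freeze _ _) (prefix _) = refl
  joins-sym (freeze _ _) (stem _) = refl
  joins-sym (freeze _ _) (guard _) = refl
  joins-sym (prefix _) (freeze _ _) = refl
  joins-sym (prefix _) (prefix _) = refl
  joins-sym (prefix _) (stem _) = refl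
  joins-sym (prefix _) (guard _) = refl
  joins-sym (stem _) (freeze _ _) = refl
  joins-sym (stem _) (prefix _) = refl
  joins-sym (stem _) (stem _) = refl
  joins-sym (stem _) (guard _) = refl
  joins-sym (guard _) (freeze _ _) = refl
  joins-sym (guard _) (prefix _) = refl
  joins-sym (guard _) (stem _) = refl
  joins-sym (guard _) (guard _) = refl

  adjacent-sym : ∀ a b → adjacent a b ≡ adjacent b a
  adjacent-sym (old x) (old y) = Graph.sym G x y
  adjacent-sym (old _) (leaf _) = refl
  adjacent-sym (old _) (twin _ _) = refl
  adjacent-sym (leaf _) (old _) = refl
  adjacent-sym (leaf _) (leaf _) = refl
  adjacent-sym (leaf _) (twin _ _) = refl
  adjacent-sym (twin _ _) (old _) = refl
  adjacent-sym (twin _ _) (leaf _) = refl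
  adjacent-sym (twin c _) (twin c′ _) = joins-sym c c′

  adjacent-irrefl : ∀ a → adjacent a a ≡ false
  adjacent-irrefl (old x) = irrefl G x
  adjacent-irrefl (leaf _) = refl
  adjacent-irrefl (twin (freeze _ _) _) = refl
  adjacent-irrefl (twin (prefix _) _) = refl
  adjacent-irrefl (twin (stem _) _) = refl
  adjacent-irrefl (twin (guard _) _) = refl

  G′ : Graph
  G′ = record
    { n = Finite.size finite-Vertex
    ; adj = λ x y → adjacent (element x) (element y)
    ; sym = λ x y → adjacent-sym (element x) (element y)
    ; irrefl = adjacent-irrefl ∘ element
    }

  ι : Fin (n G) → Fin (n G′)
  ι u = index (old u)

  ι-injective : ∀ {u v} → ι u ≡ ι v → u ≡ v
  ι-injective {u} {v} e with refl ← index-injective {old u} {old v} e = refl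

  ι-induced : InducedEmbedding G G′ ι
  ι-induced = (λ _ _ → ι-injective) , induced
    where
    induced : ∀ u v → adj G′ (ι u) (ι v) ≡ adj G u v
    induced u v rewrite element-index (old u) | element-index (old v) = refl

  hitsG : VSet (n G) → VSet (n G′) → Bool
  hitsG P W = anyF (λ u → P u ∧ W (ι u))

  observed : VSet (n G′) → Vertex → Bool
  observed W (old _) = hitsG S W
  observed W (leaf (v , i)) = active forks (v , i) ∧ (W (ι v) ∧ hitsG (below S v) W)
  observed W (twin c _) = hitsG (touches c) W

  survivor-is-sensor : ∀ {W} → W ⊆ image ι S → ∀ {u} → W (ι u) ≡ true → S u ≡ true
  survivor-is-sensor W⊆S′ {u} Wu = trans (sym (image-∋ ι ι-injective S u)) (W⊆S′ (ι u) Wu)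

  same-refl : ∀ t → same t t ≡ true
  same-refl t with t ≟ˢ t
  ... | yes _ = refl
  ... | no t≢t = ⊥-elim (t≢t refl)

  same-true : ∀ {t t′} → same t t′ ≡ true → t ≡ t′
  same-true {t} {t′} e with t ≟ˢ t′
  ... | yes t≡t′ = t≡t′

  module Hits (W : VSet (n G′)) where

    hitsG-intro : (P : VSet (n G)) (u : Fin (n G)) → P u ≡ true → W (ι u) ≡ true → hitsG P W ≡ true
    hitsG-intro P u Pu Wu = anyF-intro u (trans (cong (_∧ W (ι u)) Pu) Wu)

    hitsG-elim : {P : VSet (n G)} → hitsG P W ≡ true → ∃ λ u → P u ≡ true × W (ι u) ≡ true
    hitsG-elim e with u , e′ ← anyF-elim e = u , ∧-true e′

    hitsG-guarded : (κ : Bool) (P : VSet (n G)) → hitsG (λ x → κ ∧ P x) W ≡ κ ∧ hitsG P W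
    hitsG-guarded true P = refl
    hitsG-guarded false P = anyF-none {p = λ u → (false ∧ P u) ∧ W (ι u)} (λ _ → refl)

    observed-stem : ∀ v i β → observed W (twin (stem (v , i)) β) ≡ active forks (v , i) ∧ W (ι v)
    observed-stem v i β =
      trans (hitsG-guarded (active forks (v , i)) ⁅ v ⁆) (cong (active forks (v , i) ∧_) (anyF-⁅⁆ v (W ∘ ι)))

  module Observation (W : VSet (n G′)) (W⊆S′ : W ⊆ image ι S) where

    open Hits W

    X : VSet (n G′)
    X z = observed W (element z)

    index-of : ∀ {z b} → element z ≡ b → z ≡ index b
    index-of {z} e = trans (sym (index-element z)) (cong index e)

    adjacent⇒closedAdj : ∀ a b → adjacent a b ≡ true → closedAdj G′ (index a) (index b) ≡ true
    adjacent⇒closedAdj a b a~b =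
      trans (cong (⌊ index a Fin.≟ index b ⌋ ∨_) (trans (cong₂ adjacent (element-index a) (element-index b)) a~b))
            (∨-zeroʳ _)

    someone-survives : ∀ a → observed W a ≡ true → hitsG S W ≡ true
    someone-survives (old _) obs = obs
    someone-survives (leaf (v , i)) obs with act , rest ← ∧-true obs with Wv , _ ← ∧-true {W (ι v)} rest =
      hitsG-intro S v (proj₁ (∧-true act)) Wv
    someone-survives (twin c _) obs with u , _ , Wu ← hitsG-elim obs = hitsG-intro S u (survivor-is-sensor W⊆S′ Wu) Wu

    twin-flip : ∀ a c β → adjacent a (twin c (not β)) ≡ adjacent a (twin c β)
    twin-flip (old _) c β = refl
    twin-flip (leaf _) c β = refl
    twin-flip (twin _ _) c β = refl

    twin-flip≢ : ∀ c β → _≢_ {A = Vertex} (twin c (not β)) (twin c β)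
    twin-flip≢ c true ()
    twin-flip≢ c false ()

    -- An unobserved twin has an unobserved partner, and an unobserved leaf next to an observed
    -- stem has unobserved guards.
    second-unobserved : ∀ a b → observed W a ≡ true → adjacent a b ≡ true → observed W b ≡ false →
      ∃ λ b′ → b′ ≢ b × adjacent a b′ ≡ true × observed W b′ ≡ false
    second-unobserved a (old _) obs-a _ unobs-b with () ← trans (sym (someone-survives a obs-a)) unobs-b
    second-unobserved a (twin c β) _ a~b unobs-b =
      twin c (not β) , twin-flip≢ c β , trans (twin-flip a c β) a~b , unobs-b
    second-unobserved (twin (stem (v , i)) β) (leaf _) obs-a a~b unobs-b
      with refl ← same-true a~b
      with act , Wv ← ∧-true (trans (sym (observed-stem v i β)) obs-a) =
      twin (guard (v , i)) true , (λ ()) , same-refl (v , i) , guard-unobserved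
      where
      guard-unobserved : observed W (twin (guard (v , i)) true) ≡ false
      guard-unobserved = trans (hitsG-guarded (active forks (v , i)) (below S v))
                               (subst (λ w → active forks (v , i) ∧ (w ∧ hitsG (below S v) W) ≡ false) Wv unobs-b)
    second-unobserved (old _) (leaf _) _ () _
    second-unobserved (leaf _) (leaf _) _ () _
    second-unobserved (twin (freeze _ _) _) (leaf _) _ () _
    second-unobserved (twin (prefix _) _) (leaf _) _ () _
    second-unobserved (twin (guard _) _) (leaf _) _ () _

    outside-adjacent : ∀ {z y} → X z ≡ true → outside G′ X z y ≡ true →
                       adjacent (element z) (element y) ≡ true × X y ≡ false
    outside-adjacent {z} {y} Xz out with z~y , not-Xy ← ∧-true out with ∨-true z~y
    ... | inj₂ adjacent-zy = adjacent-zy , not-true not-Xy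
    ... | inj₁ z≡y with () ← trans (sym Xz) (subst (λ w → X w ≡ false) (sym (≟-true z≡y)) (not-true not-Xy))

    outside-intro : ∀ z b → adjacent (element z) b ≡ true → observed W b ≡ false →
                    outside G′ X z (index b) ≡ true
    outside-intro z b z~b unobs rewrite element-index b | z~b | unobs = cong (_∧ true) (∨-zeroʳ _)

    X-closed : Closed G′ X
    X-closed z Xz one
      with y , out-y ← countF-witness (outside G′ X z) one
      with z~y , Xy ← outside-adjacent Xz out-y
      with b′ , b′≢ , z~b′ , unobs ← second-unobserved (element z) (element y) Xz z~y Xy
      with s≤s () ← subst (2 ℕ.≤_) one (countF-two y (index b′) out-y (outside-intro z b′ z~b′ unobs)
                                                  (λ { refl → b′≢ (sym (element-index b′)) }))

    N⊆X : closedNbhd G′ W ⊆ X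
    N⊆X y e
      with x , e′ ← anyF-elim e
      with Wx , x~y ← ∧-true e′
      with s , refl , Ss ← image-elim ι (W⊆S′ x Wx)
      with ∨-true x~y
    ... | inj₁ ιs≡y =
      subst (λ w → X w ≡ true) (≟-true ιs≡y) (trans (cong (observed W) (element-index (old s))) (hitsG-intro S s Ss Wx))
    ... | inj₂ s~y =
      neighbour-observed (element y) (subst (λ a → adjacent a (element y) ≡ true) (element-index (old s)) s~y)
      where
      neighbour-observed : ∀ b → adjacent (old s) b ≡ true → observed W b ≡ true
      neighbour-observed (old _) _ = hitsG-intro S s Ss Wx
      neighbour-observed (twin c _) touch = hitsG-intro (touches c) s touch Wx

    R : VSet (n G′)
    R = Obs G′ W

    R-≢ : ∀ {x y} → R x ≡ true → R y ≡ false → x ≢ y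
    R-≢ Rx Ry refl with () ← trans (sym Rx) Ry

    force-into : ∀ a b → R (index a) ≡ true → adjacent a b ≡ true →
                 (∀ b′ → adjacent a b′ ≡ true → b′ ≢ b → R (index b′) ≡ true) → R (index b) ≡ true
    force-into a b Ra a~b others = force G′ (Obs-closed G′ W) Ra (adjacent⇒closedAdj a b a~b) unique
      where
      unique : ∀ z → closedAdj G′ (index a) z ≡ true → R z ≡ false → z ≡ index b
      unique z a~z Rz with z Fin.≟ index b | ∨-true a~z
      ... | yes z≡b | _ = z≡b
      ... | no _ | inj₁ a≡z = ⊥-elim (R-≢ Ra Rz (≟-true a≡z))
      ... | no z≢b | inj₂ a~z′ =
        ⊥-elim (R-≢ (subst (λ w → R w ≡ true) (index-element z)
                           (others (element z) (subst (λ a′ → adjacent a′ (element z) ≡ true) (element-index a) a~z′)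
                                   (z≢b ∘ index-of)))
                    Rz refl)

    twin-in-R : ∀ c β → observed W (twin c β) ≡ true → R (index (twin c β)) ≡ true
    twin-in-R c β obs with s , touch , Ws ← hitsG-elim obs =
      closedNbhd⊆Obs G′ W _ (anyF-intro (ι s) (trans (cong (_∧ _) Ws) (adjacent⇒closedAdj (old s) (twin c β) touch)))

    survivor-in-R : ∀ {s} → W (ι s) ≡ true → R (ι s) ≡ true
    survivor-in-R {s} Ws =
      closedNbhd⊆Obs G′ W _
        (anyF-intro (ι s) (trans (cong (_∧ _) Ws) (cong (_∨ adjacent (element (ι s)) (element (ι s))) (≟-refl (ι s)))))

    old-in-R : hitsG S W ≡ true → ∀ u → R (ι u) ≡ true
    old-in-R someone u with s , Ss , Ws ← hitsG-elim someone =
      force-into (twin (freeze u s) true) (old u)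
                 (twin-in-R (freeze u s) true (hitsG-intro (touches (freeze u s)) s touches-s Ws)) touches-u others
      where
      touches-s : touches (freeze u s) s ≡ true
      touches-s rewrite Ss | ≟-refl s = ∨-zeroʳ _
      touches-u : touches (freeze u s) u ≡ true
      touches-u rewrite Ss | ≟-refl u = refl
      others : ∀ b′ → adjacent (twin (freeze u s) true) b′ ≡ true → b′ ≢ old u → R (index b′) ≡ true
      others (old x) e b′≢u with ∨-true (proj₂ (∧-true e))
      ... | inj₁ x≡u = ⊥-elim (b′≢u (cong old (≟-true {x = x} {u} x≡u)))
      ... | inj₂ x≡s with refl ← ≟-true {x = x} {s} x≡s = survivor-in-R Ws
      others (leaf _) () _
      others (twin (freeze _ _) _) () _
      others (twin (prefix _) _) () _
      others (twin (stem _) _) () _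
      others (twin (guard _) _) () _

    leaf-in-R : ∀ v i → observed W (leaf (v , i)) ≡ true → R (index (leaf (v , i))) ≡ true
    leaf-in-R v i obs with act , rest ← ∧-true obs with Wv , below-hit ← ∧-true {W (ι v)} rest =
      force-into (twin (stem (v , i)) true) (leaf (v , i))
                 (twin-in-R (stem (v , i)) true (trans (observed-stem v i true) (trans (cong (_∧ W (ι v)) act) Wv)))
                 (same-refl (v , i)) others
      where
      others : ∀ b′ → adjacent (twin (stem (v , i)) true) b′ ≡ true → b′ ≢ leaf (v , i) →
               R (index b′) ≡ true
      others (old x) e _ with refl ← ≟-true {x = x} {v} (proj₂ (∧-true e)) =
        old-in-R (hitsG-intro S v (proj₁ (∧-true act)) Wv) v
      others (twin (guard t) γ) e _ with refl ← same-true e =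
        twin-in-R (guard (v , i)) γ
          (trans (hitsG-guarded (active forks (v , i)) (below S v)) (trans (cong (_∧ hitsG (below S v) W) act) below-hit))
      others (leaf t) e b′≢leaf with refl ← same-true e = ⊥-elim (b′≢leaf refl)
      others (twin (freeze _ _) _) () _
      others (twin (prefix _) _) () _
      others (twin (stem _) _) () _

    Obs≡observed : ∀ z → Obs G′ W z ≡ observed W (element z)
    Obs≡observed z = ⇔→≡ {z = true} (mk⇔ (Obs-least G′ W X-closed N⊆X z)
                                          (λ Xz → subst (λ w → R w ≡ true) (index-element z) (in-R (element z) Xz)))
      where
      in-R : ∀ b → observed W b ≡ true → R (index b) ≡ true
      in-R (old u) obs = old-in-R obs u
      in-R (leaf (v , i)) obs = leaf-in-R v i obs
      in-R (twin c β) obs = twin-in-R c β obs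

-- The expected value polynomial of G′

module Polynomials (G : Graph) (S : VSet (n G)) (μ : Multiplicities) where

  open Construction G S μ
  open Multiplicities μ
  open Finite finite-Vertex using (element)

  d : ℕ
  d = countF S

  S′ : VSet (n G′)
  S′ = image ι S

  twinPoly : Core → ℕ → ℤ
  twinPoly (freeze u s) = 1-X^ countF (λ x → freezeSet S u s x ∧ S x)
  twinPoly (prefix (v , i)) = when (active prefixes (v , i)) (1-X^ rank S v)
  twinPoly (stem t) = when (active forks t) (1-X^ 1)
  twinPoly (guard (v , i)) = when (active forks (v , i)) (1-X^ countF (below S v))

  poly : Vertex → ℕ → ℤ
  poly (old _) = 1-X^ d
  poly (leaf (v , i)) = when (active forks (v , i)) (leafPoly (countF (below S v)))
  poly (twin c _) = twinPoly c

  active⇒sensor : ∀ copies v i → active copies (v , i) ≡ true → S v ≡ true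
  active⇒sensor copies v i act = proj₁ (∧-true act)

  below<d : ∀ {v} → S v ≡ true → suc (countF (below S v)) ℕ.≤ d
  below<d {v} Sv = subst (ℕ._≤ d) (rank-below S Sv) (rank≤count S v)

  module _ (q : ℚ) where

    open Expectation q
    open ≡-Reasoning

    𝔼-hitsG : (P : VSet (n G)) → 𝔼 S′ (𝟙 ∘ hitsG P) ≡ 1ℚ - q ^ℚ countF (λ x → P x ∧ S x)
    𝔼-hitsG P =
      begin
        𝔼 S′ (𝟙 ∘ hitsG P)
          ≡⟨ 𝔼-cong S′ (λ W W⊆S′ → cong 𝟙 (trans (anyF-cong (keep-sensors W⊆S′))
                                                (sym (hits-image ι P∩S W)))) ⟩
        𝔼 S′ (𝟙 ∘ hits (image ι P∩S))
          ≡⟨ 𝔼-hits S′ (image ι P∩S) (image-⊆ ι (λ x e → proj₂ (∧-true e))) ⟩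
        1ℚ - q ^ℚ countF (image ι P∩S)
          ≡⟨ cong (λ k → 1ℚ - q ^ℚ k) (countF-image ι ι-injective P∩S) ⟩
        1ℚ - q ^ℚ countF P∩S
      ∎
      where
      P∩S : VSet (n G)
      P∩S x = P x ∧ S x
      keep-sensors : ∀ {W} → W ⊆ S′ → ∀ u → P u ∧ W (ι u) ≡ P∩S u ∧ W (ι u)
      keep-sensors {W} W⊆S′ u with W (ι u) in Wu
      ... | true rewrite survivor-is-sensor W⊆S′ Wu = cong (_∧ true) (sym (∧-identityʳ (P u)))
      ... | false = trans (∧-zeroʳ (P u)) (sym (∧-zeroʳ (P∩S u)))

    𝔼-hitsG-⊆ : {P : VSet (n G)} → P ⊆ S → 𝔼 S′ (𝟙 ∘ hitsG P) ≡ polyEval (1-X^ countF P) d q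
    𝔼-hitsG-⊆ {P} P⊆S =
      trans (𝔼-hitsG P) (trans (cong (λ k → 1ℚ - q ^ℚ k) (countF-cong (∩-⊆ P⊆S)))
                               (sym (polyEval-1-X^ q d (countF-mono P⊆S))))

    𝔼-when : (κ : Bool) (E : VSet (n G′) → Bool) (p : ℕ → ℤ) →
             (κ ≡ true → 𝔼 S′ (𝟙 ∘ E) ≡ polyEval p d q) →
             𝔼 S′ (λ W → 𝟙 (κ ∧ E W)) ≡ polyEval (when κ p) d q
    𝔼-when true E p 𝔼E = 𝔼E refl
    𝔼-when false E p _ = trans (𝔼-0 S′) (sym (polyEval-0 q d))

    S′-ι : ∀ {v} → S v ≡ true → S′ (ι v) ≡ true
    S′-ι {v} Sv = trans (image-∋ ι ι-injective S v) Sv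

    𝔼-observed : ∀ b → 𝔼 S′ (λ W → 𝟙 (observed W b)) ≡ polyEval (poly b) d q
    𝔼-observed (old _) = 𝔼-hitsG-⊆ (λ _ Sx → Sx)
    𝔼-observed (leaf (v , i)) = 𝔼-when (active forks (v , i)) _ _ (leaf-survives ∘ active⇒sensor forks v i)
      where
      leaf-survives : S v ≡ true →
        𝔼 S′ (λ W → 𝟙 (W (ι v) ∧ hitsG (below S v) W)) ≡ polyEval (leafPoly (countF (below S v))) d q
      leaf-survives Sv =
        begin
          𝔼 S′ (λ W → 𝟙 (W (ι v) ∧ hitsG (below S v) W))
            ≡⟨ 𝔼-cong S′ (λ W _ → cong (λ h → 𝟙 (W (ι v) ∧ h)) (sym (hits-image ι (below S v) W))) ⟩
          𝔼 S′ (λ W → 𝟙 (W (ι v) ∧ hits (image ι (below S v)) W))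
            ≡⟨ 𝔼-survives-hits S′ (image ι (below S v)) (ι v) (S′-ι Sv) (image-⊆ ι (below-⊆ S v))
                               (trans (image-∋ ι ι-injective (below S v) v) (below-irrefl S v)) ⟩
          (1ℚ - q) * (1ℚ - q ^ℚ countF (image ι (below S v)))
            ≡⟨ cong (λ k → (1ℚ - q) * (1ℚ - q ^ℚ k)) (countF-image ι ι-injective (below S v)) ⟩
          (1ℚ - q) * (1ℚ - q ^ℚ countF (below S v))
            ≡⟨ polyEval-leafPoly q d (below<d Sv) ⟨
          polyEval (leafPoly (countF (below S v))) d q
        ∎
    𝔼-observed (twin (freeze u s) _) =
      trans (𝔼-hitsG (freezeSet S u s))
            (sym (polyEval-1-X^ q d (countF-mono {p = λ x → freezeSet S u s x ∧ S x} (λ x e → proj₂ (∧-true e)))))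
    𝔼-observed (twin (prefix (v , i)) _) =
      trans (𝔼-cong S′ (λ W _ → cong 𝟙 (Hits.hitsG-guarded W (active prefixes (v , i)) (upTo S v))))
            (𝔼-when (active prefixes (v , i)) (hitsG (upTo S v)) (1-X^ rank S v) (λ _ → 𝔼-hitsG-⊆ (upTo-⊆ S v)))
    𝔼-observed (twin (stem (v , i)) β) =
      trans (𝔼-cong S′ (λ W _ → cong 𝟙 (Hits.observed-stem W v i β)))
            (𝔼-when (active forks (v , i)) (λ W → W (ι v)) (1-X^ 1) (stem-survives ∘ active⇒sensor forks v i))
      where
      stem-survives : S v ≡ true → 𝔼 S′ (λ W → 𝟙 (W (ι v))) ≡ polyEval (1-X^ 1) d q
      stem-survives Sv =
        trans (𝔼-survives S′ (ι v) (S′-ι Sv))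
              (trans (cong (λ x → 1ℚ - x) (sym (ℚP.*-identityʳ q)))
                     (sym (polyEval-1-X^ q d (ℕP.≤-trans (s≤s z≤n) (below<d Sv)))))
    𝔼-observed (twin (guard (v , i)) _) =
      trans (𝔼-cong S′ (λ W _ → cong 𝟙 (Hits.hitsG-guarded W (active forks (v , i)) (below S v))))
            (𝔼-when (active forks (v , i)) (hitsG (below S v)) (1-X^ countF (below S v))
                    (λ _ → 𝔼-hitsG-⊆ (below-⊆ S v)))

    ExpVal-G′ : ExpVal G′ S′ q ≡ polyEval (λ j → ℤΣ.sum (λ z → poly (element z) j)) d q
    ExpVal-G′ =
      begin
        ExpVal G′ S′ q
          ≡⟨ ExpVal≡𝔼 G′ S′ ⟩
        𝔼 S′ (λ W → ℕtoℚ (countF (Obs G′ W)))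
          ≡⟨ 𝔼-cong S′ (λ W W⊆S′ → cong ℕtoℚ (countF-cong (Observation.Obs≡observed W W⊆S′))) ⟩
        𝔼 S′ (λ W → ℕtoℚ (countF (λ z → observed W (element z))))
          ≡⟨ 𝔼-cong S′ (λ W _ → ℕtoℚ-countF (λ z → observed W (element z))) ⟩
        𝔼 S′ (λ W → ℚΣ.sum (λ z → 𝟙 (observed W (element z))))
          ≡⟨ 𝔼-sum S′ (λ z W → 𝟙 (observed W (element z))) ⟩
        ℚΣ.sum (λ z → 𝔼 S′ (λ W → 𝟙 (observed W (element z))))
          ≡⟨ ℚΣ.sum-cong-≗ (𝔼-observed ∘ element) ⟩
        ℚΣ.sum (λ z → polyEval (poly (element z)) d q)
          ≡⟨ polyEval-sum q (poly ∘ element) d ⟩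
        polyEval (λ j → ℤΣ.sum (λ z → poly (element z) j)) d q
      ∎

-- The coefficients of degree at least 2

open FiniteSum ℤP.+-0-commutativeMonoid using (∑; ∑-cong; ∑-⊎; ∑-×; ∑-Bool)

baseCoefficient : (G : Graph) (S : VSet (n G)) → ℕ → ℤ
baseCoefficient G S j = ∑ (finite-Fin (n G)) (λ _ → (1-X^ countF S) j) ℤ.+ (freezes ℤ.+ freezes)
  where
  freezes : ℤ
  freezes = ∑ (finite-Fin (n G) ×ᶠ finite-Fin (n G)) (λ (u , s) → (1-X^ countF (λ x → freezeSet S u s x ∧ S x)) j)

module Levels (G : Graph) (S : VSet (n G)) (μ : Multiplicities) where

  open Construction G S μ
  open Polynomials G S μ
  open Multiplicities μ

  coefficient : ℕ → ℤ
  coefficient j = ∑ finite-Vertex (λ b → poly b j)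

  module _ (j : ℕ) where

    leafSum prefixSum stemSum guardSum : ℤ
    leafSum = ∑ finite-Slot (λ t → poly (leaf t) j)
    prefixSum = ∑ finite-Slot (λ t → twinPoly (prefix t) j)
    stemSum = ∑ finite-Slot (λ t → twinPoly (stem t) j)
    guardSum = ∑ finite-Slot (λ t → twinPoly (guard t) j)

    gadgets : ℤ
    gadgets = prefixSum ℤ.+ (stemSum ℤ.+ guardSum)

    coefficient-split : coefficient j ≡ baseCoefficient G S j ℤ.+ (leafSum ℤ.+ (gadgets ℤ.+ gadgets))
    coefficient-split =
      begin
        coefficient j
          ≡⟨ ∑-⊎ (finite-Fin (n G)) (finite-Slot ⊎ᶠ (finite-Core ×ᶠ finite-Bool)) (λ b → poly b j) ⟩
        olds ℤ.+ ∑ (finite-Slot ⊎ᶠ (finite-Core ×ᶠ finite-Bool)) (λ b → poly (inj₂ b) j)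
          ≡⟨ cong (λ x → olds ℤ.+ x)
                  (∑-⊎ finite-Slot (finite-Core ×ᶠ finite-Bool) (λ b → poly (inj₂ b) j)) ⟩
        olds ℤ.+ (leafSum ℤ.+ ∑ (finite-Core ×ᶠ finite-Bool) (λ p → twinPoly (proj₁ p) j))
          ≡⟨ cong (λ x → olds ℤ.+ (leafSum ℤ.+ x)) twins ⟩
        olds ℤ.+ (leafSum ℤ.+ ((freezes ℤ.+ gadgets) ℤ.+ (freezes ℤ.+ gadgets)))
          ≡⟨ regroup olds leafSum freezes gadgets ⟩
        (olds ℤ.+ (freezes ℤ.+ freezes)) ℤ.+ (leafSum ℤ.+ (gadgets ℤ.+ gadgets))
      ∎
      where
      open ≡-Reasoning
      olds freezes : ℤ
      olds = ∑ (finite-Fin (n G)) (λ u → poly (old u) j)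
      freezes = ∑ (finite-Fin (n G) ×ᶠ finite-Fin (n G)) (λ (u , s) → twinPoly (freeze u s) j)
      tp : Core → ℤ
      tp c = twinPoly c j
      cores : ∑ finite-Core tp ≡ freezes ℤ.+ gadgets
      cores =
        trans (∑-⊎ (finite-Fin (n G) ×ᶠ finite-Fin (n G)) (finite-Slot ⊎ᶠ (finite-Slot ⊎ᶠ finite-Slot)) tp)
              (cong (λ x → freezes ℤ.+ x)
                    (trans (∑-⊎ finite-Slot (finite-Slot ⊎ᶠ finite-Slot) (tp ∘ inj₂))
                           (cong (λ x → prefixSum ℤ.+ x) (∑-⊎ finite-Slot finite-Slot (tp ∘ inj₂ ∘ inj₂)))))
      twins : ∑ (finite-Core ×ᶠ finite-Bool) (tp ∘ proj₁) ≡ (freezes ℤ.+ gadgets) ℤ.+ (freezes ℤ.+ gadgets)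
      twins = trans (∑-× finite-Core finite-Bool (tp ∘ proj₁))
              (trans (∑-cong finite-Core (λ c → ∑-Bool (λ _ → tp c)))
              (trans (ℤΣ.∑-distrib-+ (tp ∘ Finite.element finite-Core) (tp ∘ Finite.element finite-Core))
                     (cong₂ ℤ._+_ cores cores)))
      regroup : ∀ o l f g →
                o ℤ.+ (l ℤ.+ ((f ℤ.+ g) ℤ.+ (f ℤ.+ g))) ≡ (o ℤ.+ (f ℤ.+ f)) ℤ.+ (l ℤ.+ (g ℤ.+ g))
      regroup = solve-∀

  module _ (fits : ∀ k → k ℕ.≤ d → prefixes k ℕ.≤ slots × forks k ℕ.≤ slots)
           (top : forks (suc d) ≡ 0) where

    ∑-active : (copies : ℕ → ℕ) → (∀ k → k ℕ.≤ d → copies k ℕ.≤ slots) → (g : ℕ → ℤ) →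
      ∑ finite-Slot (λ t → if active copies t then g (rank S (proj₁ t)) else + 0)
        ≡ sum {d} (λ k → + copies (suc (toℕ k)) ℤ.* g (suc (toℕ k)))
    ∑-active copies copies-fit g =
      trans (∑-× (finite-Fin (n G)) (finite-Fin slots) _)
            (trans (sum-cong-≗ per-sensor) (sum-rank S (λ r → + copies r ℤ.* g r)))
      where
      per-sensor : ∀ v → ∑ (finite-Fin slots) (λ i → if active copies (v , i) then g (rank S v) else + 0)
                           ≡ (if S v then + copies (rank S v) ℤ.* g (rank S v) else + 0)
      per-sensor v with S v
      ... | true = sum-first slots (copies (rank S v)) (g (rank S v)) (copies-fit (rank S v) (rank≤count S v))
      ... | false = sum-zero {slots} (λ _ → refl)

    guarded-below : ∀ copies (h : ℕ → ℕ → ℤ) v i j →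
      when (active copies (v , i)) (h (countF (below S v))) j
        ≡ (if active copies (v , i) then h (pred (rank S v)) j else + 0)
    guarded-below copies h v i j with active copies (v , i) in act
    ... | false = refl
    ... | true = cong (λ b → h b j) (cong pred (sym (rank-below S (proj₁ (∧-true act)))))

    module _ (j′ : ℕ) (j≤d : suc (suc j′) ℕ.≤ d) where

      private
        j : ℕ
        j = suc (suc j′)

        a : ℕ → ℤ
        a m = + forks (suc m)

        a-top : a d ≡ + 0
        a-top = cong +_ top

        negate : ∀ a x → a ℤ.* (+ 0 ℤ.- x) ≡ ℤ.- (a ℤ.* x)
        negate = solve-∀

      open ≡-Reasoning

      leafSum-level : leafSum j ≡ + forks j ℤ.- + forks (suc j)
      leafSum-level =
        begin
          leafSum j
            ≡⟨ ∑-cong finite-Slot (λ (v , i) → guarded-below forks leafPoly v i j) ⟩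
          ∑ finite-Slot (λ t → if active forks t then leafPoly (pred (rank S (proj₁ t))) j else + 0)
            ≡⟨ ∑-active forks (λ k k≤d → proj₂ (fits k k≤d)) (λ r → leafPoly (pred r) j) ⟩
          sum {d} (λ k → a (toℕ k) ℤ.* leafPoly (toℕ k) j)
            ≡⟨ sum-cong-≗ {d} (λ k → split (a (toℕ k)) ((X^ toℕ k) j) ((X^ suc (toℕ k)) j)) ⟩
          sum {d} (λ k → a (toℕ k) ℤ.* (X^ suc (toℕ k)) j ℤ.+ ℤ.- (a (toℕ k) ℤ.* (X^ toℕ k) j))
            ≡⟨ ℤΣ.∑-distrib-+ {d} (λ k → a (toℕ k) ℤ.* (X^ suc (toℕ k)) j)
                                   (λ k → ℤ.- (a (toℕ k) ℤ.* (X^ toℕ k) j)) ⟩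
          sum {d} (λ k → a (toℕ k) ℤ.* (X^ toℕ k) (suc j′)) ℤ.+
          sum {d} (λ k → ℤ.- (a (toℕ k) ℤ.* (X^ toℕ k) j))
            ≡⟨ cong₂ ℤ._+_ (sum-X^ d a (suc j′) j≤d)
                           (trans (sum-neg {d} _) (cong ℤ.-_ (sum-X^-upTo d a j a-top j≤d))) ⟩
          + forks j ℤ.- + forks (suc j)
        ∎
        where
        split : ∀ a x y → a ℤ.* ((+ 0 ℤ.- + 0) ℤ.- x ℤ.+ y) ≡ a ℤ.* y ℤ.+ ℤ.- (a ℤ.* x)
        split = solve-∀

      prefixSum-level : prefixSum j ≡ ℤ.- + prefixes j
      prefixSum-level =
        begin
          prefixSum j
            ≡⟨ ∑-active prefixes (λ k k≤d → proj₁ (fits k k≤d)) (λ r → (1-X^ r) j) ⟩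
          sum {d} (λ k → + prefixes (suc (toℕ k)) ℤ.* (1-X^ suc (toℕ k)) j)
            ≡⟨ sum-cong-≗ {d} (λ k → negate (+ prefixes (suc (toℕ k))) ((X^ toℕ k) (suc j′))) ⟩
          sum {d} (λ k → ℤ.- (+ prefixes (suc (toℕ k)) ℤ.* (X^ toℕ k) (suc j′)))
            ≡⟨ trans (sum-neg {d} _) (cong ℤ.-_ (sum-X^ d (λ m → + prefixes (suc m)) (suc j′) j≤d)) ⟩
          ℤ.- + prefixes j
        ∎

      stemSum-level : stemSum j ≡ + 0
      stemSum-level = sum-zero (λ z → vanishes (active forks (Finite.element finite-Slot z)))
        where
        vanishes : ∀ b → (if b then (1-X^ 1) j else + 0) ≡ + 0
        vanishes true = refl
        vanishes false = refl

      guardSum-level : guardSum j ≡ ℤ.- + forks (suc j)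
      guardSum-level =
        begin
          guardSum j
            ≡⟨ ∑-cong finite-Slot (λ (v , i) → guarded-below forks (λ b → 1-X^ b) v i j) ⟩
          ∑ finite-Slot (λ t → if active forks t then (1-X^ pred (rank S (proj₁ t))) j else + 0)
            ≡⟨ ∑-active forks (λ k k≤d → proj₂ (fits k k≤d)) (λ r → (1-X^ pred r) j) ⟩
          sum {d} (λ k → a (toℕ k) ℤ.* (1-X^ toℕ k) j)
            ≡⟨ sum-cong-≗ {d} (λ k → negate (a (toℕ k)) ((X^ toℕ k) j)) ⟩
          sum {d} (λ k → ℤ.- (a (toℕ k) ℤ.* (X^ toℕ k) j))
            ≡⟨ trans (sum-neg {d} _) (cong ℤ.-_ (sum-X^-upTo d a j a-top j≤d)) ⟩
          ℤ.- + forks (suc j)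
        ∎

      coefficient-level : coefficient j ≡
        baseCoefficient G S j ℤ.+ (+ forks j ℤ.- + 2 ℤ.* + prefixes j ℤ.- + 3 ℤ.* + forks (suc j))
      coefficient-level =
        begin
          coefficient j
            ≡⟨ coefficient-split j ⟩
          baseCoefficient G S j ℤ.+ (leafSum j ℤ.+ (gadgets j ℤ.+ gadgets j))
            ≡⟨ cong₂ (λ l g → baseCoefficient G S j ℤ.+ (l ℤ.+ (g ℤ.+ g))) leafSum-level
                     (cong₂ ℤ._+_ prefixSum-level (cong₂ ℤ._+_ stemSum-level guardSum-level)) ⟩
          baseCoefficient G S j ℤ.+ ((f ℤ.- f′) ℤ.+ (g ℤ.+ g))
            ≡⟨ collect (baseCoefficient G S j) f p f′ ⟩
          baseCoefficient G S j ℤ.+ (f ℤ.- + 2 ℤ.* p ℤ.- + 3 ℤ.* f′)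
        ∎
        where
        f p f′ g : ℤ
        f = + forks j
        p = + prefixes j
        f′ = + forks (suc j)
        g = ℤ.- p ℤ.+ (+ 0 ℤ.+ ℤ.- f′)
        collect : ∀ b f p f′ → let g = ℤ.- p ℤ.+ (+ 0 ℤ.+ ℤ.- f′) in
                  b ℤ.+ ((f ℤ.- f′) ℤ.+ (g ℤ.+ g)) ≡ b ℤ.+ (f ℤ.- + 2 ℤ.* p ℤ.- + 3 ℤ.* f′)
        collect = solve-∀

negPart : ℤ → ℕ
negPart (+ _) = 0
negPart -[1+ n ] = suc n

∣∣-2negPart : ∀ D → + ∣ D ∣ ℤ.- + 2 ℤ.* + negPart D ≡ D
∣∣-2negPart (+ n) = no-correction (+ n)
  where
  no-correction : ∀ x → x ℤ.- + 2 ℤ.* + 0 ≡ x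
  no-correction = solve-∀
∣∣-2negPart -[1+ n ] = flip-sign (+ suc n)
  where
  flip-sign : ∀ x → x ℤ.- + 2 ℤ.* x ≡ ℤ.- x
  flip-sign = solve-∀

sumUpTo : (ℕ → ℕ) → ℕ → ℕ
sumUpTo f zero = f zero
sumUpTo f (suc m) = sumUpTo f m ℕ.+ f (suc m)

sumUpTo-≥ : ∀ f {k} m → k ℕ.≤ m → f k ℕ.≤ sumUpTo f m
sumUpTo-≥ f zero z≤n = ℕP.≤-refl
sumUpTo-≥ f (suc m) k≤1+m with ℕP.m≤n⇒m<n∨m≡n k≤1+m
... | inj₁ (s≤s k≤m) = ℕP.≤-trans (sumUpTo-≥ f m k≤m) (ℕP.m≤m+n _ _)
... | inj₂ refl = ℕP.m≤n+m _ _

-- The coefficient of q^j is base + r - 2m - 3r′, where r and m count the forks and prefix pairs of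
-- rank j and r′ the forks of rank j + 1.  So the ranks are handled from d downwards, and
-- r - 2m = demand j r′ is met by r = ∣ demand j r′ ∣ and m = negPart (demand j r′).
module Solution (G : Graph) (S : VSet (n G)) (c : ℕ → ℤ) where

  d : ℕ
  d = countF S

  demand : ℕ → ℕ → ℤ
  demand j r′ = c j ℤ.- baseCoefficient G S j ℤ.+ + 3 ℤ.* + r′

  forksFrom : ℕ → ℕ → ℕ
  forksFrom zero j = 0
  forksFrom (suc t) j = ∣ demand j (forksFrom t (suc j)) ∣

  forks : ℕ → ℕ
  forks j = forksFrom (suc d ∸ j) j

  prefixes : ℕ → ℕ
  prefixes j = negPart (demand j (forks (suc j)))

  forks-step : ∀ {j} → j ℕ.≤ d → forks j ≡ ∣ demand j (forks (suc j)) ∣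
  forks-step {j} j≤d rewrite ℕP.+-∸-assoc 1 j≤d = refl

  forks-top : forks (suc d) ≡ 0
  forks-top rewrite ℕP.n∸n≡0 d = refl

  μ : Multiplicities
  μ = record { slots = sumUpTo (λ k → prefixes k ℕ.+ forks k) d ; prefixes = prefixes ; forks = forks }

  fits : ∀ k → k ℕ.≤ d → prefixes k ℕ.≤ Multiplicities.slots μ × forks k ℕ.≤ Multiplicities.slots μ
  fits k k≤d = ℕP.≤-trans (ℕP.m≤m+n _ _) bound , ℕP.≤-trans (ℕP.m≤n+m _ _) bound
    where
    bound : prefixes k ℕ.+ forks k ℕ.≤ Multiplicities.slots μ
    bound = sumUpTo-≥ (λ k → prefixes k ℕ.+ forks k) d k≤d

  open Levels G S μ

  coefficients : ∀ j → j ℕ.≤ d → coefficient j ≡ withLow c (coefficient 1) (coefficient 0) j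
  coefficients zero _ = refl
  coefficients (suc zero) _ = refl
  coefficients (suc (suc j′)) j≤d =
    begin
      coefficient j
        ≡⟨ coefficient-level fits forks-top j′ j≤d ⟩
      base ℤ.+ (+ forks j ℤ.- + 2 ℤ.* + negPart D ℤ.- + 3 ℤ.* r′)
        ≡⟨ cong (λ r → base ℤ.+ (+ r ℤ.- + 2 ℤ.* + negPart D ℤ.- + 3 ℤ.* r′)) (forks-step j≤d) ⟩
      base ℤ.+ (+ ∣ D ∣ ℤ.- + 2 ℤ.* + negPart D ℤ.- + 3 ℤ.* r′)
        ≡⟨ cong (λ x → base ℤ.+ (x ℤ.- + 3 ℤ.* r′)) (∣∣-2negPart D) ⟩
      base ℤ.+ (D ℤ.- + 3 ℤ.* r′)
        ≡⟨ cancel (c j) base r′ ⟩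
      c j
    ∎
    where
    open ≡-Reasoning
    j : ℕ
    j = suc (suc j′)
    base r′ D : ℤ
    base = baseCoefficient G S j
    r′ = + forks (suc j)
    D = demand j (forks (suc j))
    cancel : ∀ c b r → b ℤ.+ ((c ℤ.- b ℤ.+ + 3 ℤ.* r) ℤ.- + 3 ℤ.* r) ≡ c
    cancel = solve-∀

-- The identity holds for every rational q.
theorem2p7 : (d : ℕ) (G : Graph) (S : VSet (n G)) → countF S ≡ d →
    (c : ℕ → ℤ) →
    Σ Graph (λ G' → Σ (Fin (n G) → Fin (n G')) (λ f →
    InducedEmbedding G G' f ×
    Σ ℤ (λ c₁ → Σ ℤ (λ c₀ →
    (q : ℚ) → 0ℚ ≤ q → q ≤ 1ℚ →
    ExpVal G' (image f S) q ≡ polyEval (withLow c c₁ c₀) d q))))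
theorem2p7 .(countF S) G S refl c =
  G′ , ι , ι-induced , coefficient 1 , coefficient 0 ,
  λ q _ _ → trans (ExpVal-G′ q) (polyEval-cong q (countF S) coefficients)
  where
  open Solution G S c
  open Construction G S μ
  open Polynomials G S μ
  open Levels G S μ
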